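{- For every integer $k\ge1$ and every integer $M\ge0$, $$\sum_{n_1\ge0}\cdots\sum_{n_{k}\ge0}\frac{q^{n_1^2+n_2^2+\cdots+n_k^2+Mn_{k}}}{(q)_{n_1-n_2}(q)_{n_2-n_3}\cdots(q)_{n_{k-1}-n_{k}}(q)_{n_{k}}(q)_{n_{k}+M}}=\frac{1}{(q)_{\infty}(q)_{M}}+\frac{(q)_{M}}{(q)_{\infty}}\sum_{n=1}^{M}\frac{(-1)^n(1+q^n)q^{n((2k+1)n-1)/2}}{(q)_{M-n}(q)_{M+n}}.$$ (For $k=1$ the left side is $\sum_{n_1\ge0} q^{n_1^2+Mn_1}/((q)_{n_1}(q)_{n_1+M})$.)
   Context: Here $q$ is a complex number with $|q|<1$, $(q)_n=\prod_{i=1}^{n}(1-q^i)$ for $n\ge0$ with $(q)_0=1$, $(q)_\infty=\prod_{i\ge1}(1-q^i)$, and $1/(q)_m$ is interpreted as $0$ for negative integers $m$ (so effectively the sum is over $n_1\ge n_2\ge\cdots\ge n_k\ge0$). -}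

module Defs where

-- A q-series identity
-- valid for all complex |q| < 1 is equivalent (uniqueness of power series
-- coefficients) to the equality of all coefficients of the corresponding
-- formal power series; we state the corollary in that form.

open import Data.Nat as ℕ using (ℕ; zero; suc; _∸_; _≤?_; _/_)
open import Data.Nat.DivMod using (_%_)
open import Data.Integer as ℤ using (ℤ; +_; -_)
open import Data.List using (List; []; _∷_; foldr; map; concatMap; upTo)
open import Data.Vec as Vec using (Vec; []; _∷_)
open import Relation.Nullary using (yes; no)

PS : Set
PS = ℕ → ℤ

sumℤ : List ℤ → ℤ
sumℤ = foldr ℤ._+_ (+ 0)

Σ≤ : ℕ → (ℕ → ℤ) → ℤ
Σ≤ N f = sumℤ (map f (upTo (suc N)))

0ₚ : PS
0ₚ _ = + 0

qPow : ℕ → PS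
qPow e N with e ℕ.≟ N
... | yes _ = + 1
... | no  _ = + 0

1ₚ : PS
1ₚ = qPow 0

_+ₚ_ : PS → PS → PS
(f +ₚ g) N = f N ℤ.+ g N
infixl 6 _+ₚ_

-ₚ_ : PS → PS
(-ₚ f) N = - f N

_*ₚ_ : PS → PS → PS
(f *ₚ g) N = Σ≤ N (λ i → f i ℤ.* g (N ∸ i))
infixl 7 _*ₚ_

sign : ℕ → PS
sign zero    = 1ₚ
sign (suc n) = -ₚ sign n

poch : ℕ → PS
poch zero    = 1ₚ
poch (suc n) = poch n *ₚ (1ₚ +ₚ (-ₚ qPow (suc n)))

-- geomInv d = 1/(1 - q^{d+1}) = Σ_{j ≥ 0} q^{(d+1) j}
geomInv : (d : ℕ) → PS
geomInv d N with N % suc d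
... | zero  = + 1
... | suc _ = + 0

invPoch : ℕ → PS
invPoch zero    = 1ₚ
invPoch (suc n) = invPoch n *ₚ geomInv n

-- 1/(q)_∞ : its coefficient of q^N coincides with that of 1/(q)_N
-- (the factors 1/(1-q^i) with i > N do not affect coefficients up to q^N)
invInf : PS
invInf N = invPoch N N

-- 1/(q)_{n - m} with the convention 1/(q)_{negative} = 0
invPochDiff : ℕ → ℕ → PS
invPochDiff n m with m ≤? n
... | yes _ = invPoch (n ∸ m)
... | no  _ = 0ₚ

denom : ℕ → {k : ℕ} → Vec ℕ (suc k) → PS
denom M (n ∷ [])         = invPoch n *ₚ invPoch (n ℕ.+ M)
denom M (n ∷ m ∷ ns)     = invPochDiff n m *ₚ denom M (m ∷ ns)

sumSq : {k : ℕ} → Vec ℕ k → ℕ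
sumSq []       = 0
sumSq (n ∷ ns) = n ℕ.* n ℕ.+ sumSq ns

summand : ℕ → {k : ℕ} → Vec ℕ (suc k) → PS
summand M v = qPow (sumSq v ℕ.+ M ℕ.* Vec.last v) *ₚ denom M v

tuples : (k N : ℕ) → List (Vec ℕ k)
tuples zero    N = [] ∷ []
tuples (suc k) N = concatMap (λ n → map (n ∷_) (tuples k N)) (upTo (suc N))

-- The coefficient of q^N only receives
-- contributions from tuples with all nᵢ ≤ N: a nonzero summand has
-- n₁ ≥ n₂ ≥ … ≥ n_k and q-order ≥ n₁² ≥ n₁.  So the coefficient of q^N
-- of the full (infinite) sum is the finite sum below.
LHS : (k M : ℕ) → PS
LHS zero    M N = + 0   -- unused: the statement assumes k ≥ 1
LHS (suc k) M N = sumℤ (map (λ v → summand M v N) (tuples (suc k) N))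

-- exponent n((2k+1)n - 1)/2 (always an integer)
expo : (k n : ℕ) → ℕ
expo k n = (n ℕ.* ((2 ℕ.* k ℕ.+ 1) ℕ.* n ∸ 1)) / 2

innerSum : (k M : ℕ) → PS
innerSum k M N =
  sumℤ (map (λ n → (sign n *ₚ (1ₚ +ₚ qPow n) *ₚ qPow (expo k n)
                     *ₚ invPoch (M ∸ n) *ₚ invPoch (M ℕ.+ n)) N)
            (Data.List.drop 1 (upTo (suc M))))
  where import Data.List

RHS : (k M : ℕ) → PS
RHS k M = invInf *ₚ invPoch M +ₚ poch M *ₚ invInf *ₚ innerSum k M

-- The left side is Σₙ q^{n²} β⁽ᵏ⁻¹⁾ₙ, where β⁽⁰⁾_L = q^{ML} / ((q)_L (q)_{L+M}) and
-- β⁽ⁱ⁺¹⁾_L = Σ_{j ≤ L} q^{j²} β⁽ⁱ⁾_j / (q)_{L−j} is the β-side of the Bailey lemma with a = 1, ρ₁, ρ₂ → ∞.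
-- β⁽⁰⁾ is the β of a Bailey pair whose α_r = (q)_M α⁰_r / ((q)_{M−r} (q)_{M+r}) is built from the unit pair
-- α⁰_0 = 1, α⁰_r = (−1)^r q^{r(r−1)/2} (1 + q^r), β⁰_L = δ_{L0}; this is checked after one application of the
-- (injective) Bailey map, where both sides become q-Pfaff–Saalschütz sums. Each application of the Bailey
-- lemma multiplies α_r by q^{r²}, and letting L → ∞ in the pair relation gives
-- Σₙ q^{n²} βₙ = (1/(q)_∞) Σ_r q^{r²} α_r, which is the right side. The unit pair is the vanishing of
-- Σ_j (−1)^j q^{(j−L)(j−L−1)/2} [2L choose j]_q for L ≥ 1, the q-binomial theorem at z = q^{−L}.

module Submission where

open import Defs
open import Algebra.Bundles using (AbelianGroup; Ring; CommutativeRing; CommutativeMonoid)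
open import Algebra.Structures using (IsCommutativeRing)
import Algebra.Solver.Ring.AlmostCommutativeRing as ACR
open import Data.Empty using (⊥-elim)
open import Data.Integer as ℤ using (ℤ; +_; -_) renaming (_+_ to _+ᶻ_; _*_ to _*ᶻ_)
import Data.Integer.Properties as ℤP
open import Algebra.Properties.Group (AbelianGroup.group ℤP.+-0-abelianGroup) using (∙-cancelʳ)
import Data.Integer.Tactic.RingSolver as ℤ-Solver
open import Data.List using ([]; _∷_; map; applyUpTo; upTo; concat; _++_)
import Data.List.Properties as List
open import Data.Maybe using (Maybe; just; nothing)
open import Data.Nat as ℕ
  using (ℕ; zero; suc; _+_; _*_; _∸_; _≤_; _<_; z≤n; s≤s; less; equal; greater; _≤′_; ≤′-refl; ≤′-step)
import Data.Nat.Properties as ℕP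
open import Data.Nat.Induction using (<-rec)
import Data.Nat.Tactic.RingSolver as ℕ-Solver
open import Data.Nat.DivMod using (_%_; _/_; [m+n]%n≡m%n; m<n⇒m%n≡m; m*n/n≡m)
open import Data.Product using (_,_)
open import Data.Sum using (inj₁; inj₂)
open import Data.Vec as Vec using (Vec; []; _∷_)
open import Function using (_∘_; id)
open import Relation.Binary.PropositionalEquality as ≡
  using (_≡_; _≢_; _≗_; refl; cong; cong₂; cong-app; trans; subst; module ≡-Reasoning)
open import Relation.Nullary using (yes; no)

module FiniteSums {c ℓ} (R : Ring c ℓ) where

  open Ring R
    using (Carrier; _≈_; 0#; setoid; +-cong; +-congˡ; +-comm; +-assoc; +-identityˡ; +-identityʳ;
           distribˡ; distribʳ; zeroˡ; zeroʳ; +-commutativeMonoid)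
    renaming (_+_ to _⊕_; _*_ to _⊛_; refl to ≈-refl; sym to ≈-sym; trans to ≈-trans; reflexive to ≈-reflexive)
  open import Algebra.Properties.CommutativeSemigroup
    (CommutativeMonoid.commutativeSemigroup +-commutativeMonoid) using (interchange)
  open import Relation.Binary.Reasoning.Setoid setoid

  ∑ : ℕ → (ℕ → Carrier) → Carrier
  ∑ zero    f = 0#
  ∑ (suc n) f = f 0 ⊕ ∑ n (f ∘ suc)

  syntax ∑ n (λ i → x) = ∑[ i < n ] x

  ∑-cong : ∀ n {f g} → (∀ i → i < n → f i ≈ g i) → ∑ n f ≈ ∑ n g
  ∑-cong zero    _   = ≈-refl
  ∑-cong (suc n) f≈g = +-cong (f≈g 0 (s≤s z≤n)) (∑-cong n (λ i i<n → f≈g (suc i) (s≤s i<n)))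

  ∑-cong-≗ : ∀ n {f g} → (∀ i → f i ≈ g i) → ∑ n f ≈ ∑ n g
  ∑-cong-≗ n f≈g = ∑-cong n (λ i _ → f≈g i)

  ∑-zero : ∀ n {f} → (∀ i → i < n → f i ≈ 0#) → ∑ n f ≈ 0#
  ∑-zero zero    _   = ≈-refl
  ∑-zero (suc n) f≈0 =
    ≈-trans (+-cong (f≈0 0 (s≤s z≤n)) (∑-zero n (λ i i<n → f≈0 (suc i) (s≤s i<n)))) (+-identityʳ 0#)

  ∑-distrib-+ : ∀ n (f g : ℕ → Carrier) → ∑[ i < n ] (f i ⊕ g i) ≈ ∑ n f ⊕ ∑ n g
  ∑-distrib-+ zero    f g = ≈-sym (+-identityʳ 0#)
  ∑-distrib-+ (suc n) f g =
    ≈-trans (+-congˡ (∑-distrib-+ n (f ∘ suc) (g ∘ suc))) (interchange (f 0) (g 0) _ _)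

  *-distribˡ-∑ : ∀ n c (f : ℕ → Carrier) → c ⊛ ∑ n f ≈ ∑[ i < n ] (c ⊛ f i)
  *-distribˡ-∑ zero    c f = zeroʳ c
  *-distribˡ-∑ (suc n) c f = ≈-trans (distribˡ c (f 0) _) (+-congˡ (*-distribˡ-∑ n c (f ∘ suc)))

  *-distribʳ-∑ : ∀ n c (f : ℕ → Carrier) → ∑ n f ⊛ c ≈ ∑[ i < n ] (f i ⊛ c)
  *-distribʳ-∑ zero    c f = zeroˡ c
  *-distribʳ-∑ (suc n) c f = ≈-trans (distribʳ c (f 0) _) (+-congˡ (*-distribʳ-∑ n c (f ∘ suc)))

  ∑-init-last : ∀ n (f : ℕ → Carrier) → ∑ (suc n) f ≈ ∑ n f ⊕ f n
  ∑-init-last zero    f = ≈-trans (+-identityʳ (f 0)) (≈-sym (+-identityˡ (f 0)))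
  ∑-init-last (suc n) f = ≈-trans (+-congˡ (∑-init-last n (f ∘ suc))) (≈-sym (+-assoc (f 0) _ _))

  ∑-swap : ∀ m n (F : ℕ → ℕ → Carrier) → ∑[ i < m ] ∑[ j < n ] F i j ≈ ∑[ j < n ] ∑[ i < m ] F i j
  ∑-swap zero    n F = ≈-sym (∑-zero n (λ _ _ → ≈-refl))
  ∑-swap (suc m) n F =
    ≈-trans (+-congˡ (∑-swap m n (F ∘ suc))) (≈-sym (∑-distrib-+ n (F 0) (λ j → ∑[ i < m ] F (suc i) j)))

  ∑-split : ∀ m n (f : ℕ → Carrier) → ∑ (m + n) f ≈ ∑ m f ⊕ ∑[ i < n ] f (m + i)
  ∑-split zero    n f = ≈-sym (+-identityˡ _)
  ∑-split (suc m) n f = ≈-trans (+-congˡ (∑-split m n (f ∘ suc))) (≈-sym (+-assoc (f 0) _ _))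

  ∑-truncate : ∀ {m n} f → m ≤ n → (∀ i → m ≤ i → f i ≈ 0#) → ∑ n f ≈ ∑ m f
  ∑-truncate {m} {n} f m≤n tail≈0 = begin
    ∑ n f                             ≡⟨ cong (λ k → ∑ k f) (≡.sym (ℕP.m+[n∸m]≡n m≤n)) ⟩
    ∑ (m + (n ∸ m)) f                 ≈⟨ ∑-split m (n ∸ m) f ⟩
    ∑ m f ⊕ ∑[ i < n ∸ m ] f (m + i)  ≈⟨ +-congˡ (∑-zero (n ∸ m) (λ i _ → tail≈0 (m + i) (ℕP.m≤m+n m i))) ⟩
    ∑ m f ⊕ 0#                        ≈⟨ +-identityʳ _ ⟩
    ∑ m f                             ∎

  ∑-drop : ∀ {r n} f → r ≤ n → (∀ i → i < r → f i ≈ 0#) → ∑ n f ≈ ∑[ s < n ∸ r ] f (r + s)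
  ∑-drop {r} {n} f r≤n head≈0 = begin
    ∑ n f                             ≡⟨ cong (λ k → ∑ k f) (≡.sym (ℕP.m+[n∸m]≡n r≤n)) ⟩
    ∑ (r + (n ∸ r)) f                 ≈⟨ ∑-split r (n ∸ r) f ⟩
    ∑ r f ⊕ ∑[ s < n ∸ r ] f (r + s)  ≈⟨ +-cong (∑-zero r head≈0) ≈-refl ⟩
    0# ⊕ ∑[ s < n ∸ r ] f (r + s)     ≈⟨ +-identityˡ _ ⟩
    ∑[ s < n ∸ r ] f (r + s)          ∎

  ∑-reverse : ∀ n (f : ℕ → Carrier) → ∑ n f ≈ ∑[ i < n ] f (n ∸ suc i)
  ∑-reverse zero    f = ≈-refl
  ∑-reverse (suc n) f = begin
    f 0 ⊕ ∑ n (f ∘ suc)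
      ≈⟨ +-congˡ (∑-reverse n (f ∘ suc)) ⟩
    f 0 ⊕ ∑[ i < n ] f (suc (n ∸ suc i))
      ≈⟨ +-comm _ _ ⟩
    ∑[ i < n ] f (suc (n ∸ suc i)) ⊕ f 0
      ≈⟨ +-cong (∑-cong n (λ i i<n → ≈-reflexive (cong f (≡.sym (ℕP.+-∸-assoc 1 i<n)))))
                (≈-reflexive (cong f (≡.sym (ℕP.n∸n≡0 n)))) ⟩
    ∑[ i < n ] f (n ∸ i) ⊕ f (n ∸ n)
      ≈⟨ ≈-sym (∑-init-last n (λ i → f (n ∸ i))) ⟩
    ∑[ i < suc n ] f (n ∸ i)
      ∎

-- The ring of formal power series

module ℤ∑ = FiniteSums ℤP.+-*-ring

sumℤ-applyUpTo : ∀ (f : ℕ → ℤ) g n → sumℤ (map f (applyUpTo g n)) ≡ ℤ∑.∑ n (f ∘ g)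
sumℤ-applyUpTo f g zero    = refl
sumℤ-applyUpTo f g (suc n) = cong (f (g 0) +ᶻ_) (sumℤ-applyUpTo f (g ∘ suc) n)

*ₚ-coeff : ∀ f g N → (f *ₚ g) N ≡ ℤ∑.∑ (suc N) (λ i → f i *ᶻ g (N ∸ i))
*ₚ-coeff f g N = sumℤ-applyUpTo (λ i → f i *ᶻ g (N ∸ i)) id (suc N)

*ₚ-coeff-zero : ∀ f g → (f *ₚ g) 0 ≡ f 0 *ᶻ g 0
*ₚ-coeff-zero f g = ℤP.+-identityʳ (f 0 *ᶻ g 0)

*ₚ-coeff-suc : ∀ f g N → (f *ₚ g) (suc N) ≡ f 0 *ᶻ g (suc N) +ᶻ ((f ∘ suc) *ₚ g) N
*ₚ-coeff-suc f g N =
  trans (*ₚ-coeff f g (suc N)) (cong (f 0 *ᶻ g (suc N) +ᶻ_) (≡.sym (*ₚ-coeff (f ∘ suc) g N)))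

qPow-diag : ∀ e → qPow e e ≡ + 1
qPow-diag e with e ℕ.≟ e
... | yes _   = refl
... | no e≢e  = ⊥-elim (e≢e refl)

qPow-off : ∀ {e N} → e ≢ N → qPow e N ≡ + 0
qPow-off {e} {N} e≢N with e ℕ.≟ N
... | yes e≡N = ⊥-elim (e≢N e≡N)
... | no _    = refl

qPow-suc : ∀ e N → qPow (suc e) (suc N) ≡ qPow e N
qPow-suc e N with e ℕ.≟ N
... | yes refl = qPow-diag (suc e)
... | no e≢N   = qPow-off (e≢N ∘ ℕP.suc-injective)

∑-qPow-< : ∀ {a n} (F : ℕ → ℤ) → a < n → ℤ∑.∑ n (λ i → qPow a i *ᶻ F i) ≡ F a
∑-qPow-< {zero}  {suc n} F _ =
  trans (cong₂ _+ᶻ_ (ℤP.*-identityˡ (F 0)) (ℤ∑.∑-zero n (λ i _ → ℤP.*-zeroˡ (F (suc i)))))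
        (ℤP.+-identityʳ (F 0))
∑-qPow-< {suc a} {suc n} F (s≤s a<n) =
  trans (ℤP.+-identityˡ _)
        (trans (ℤ∑.∑-cong-≗ n (λ i → cong (_*ᶻ F (suc i)) (qPow-suc a i))) (∑-qPow-< (F ∘ suc) a<n))

∑-qPow-≥ : ∀ {a n} (F : ℕ → ℤ) → n ≤ a → ℤ∑.∑ n (λ i → qPow a i *ᶻ F i) ≡ + 0
∑-qPow-≥ {_}     {zero}  F _         = refl
∑-qPow-≥ {suc a} {suc n} F (s≤s n≤a) =
  trans (ℤP.+-identityˡ _)
        (trans (ℤ∑.∑-cong-≗ n (λ i → cong (_*ᶻ F (suc i)) (qPow-suc a i))) (∑-qPow-≥ (F ∘ suc) n≤a))

qPow-*ₚ-≤ : ∀ {a N} f → a ≤ N → (qPow a *ₚ f) N ≡ f (N ∸ a)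
qPow-*ₚ-≤ {a} {N} f a≤N = trans (*ₚ-coeff (qPow a) f N) (∑-qPow-< (λ i → f (N ∸ i)) (s≤s a≤N))

qPow-*ₚ-> : ∀ {a N} f → N < a → (qPow a *ₚ f) N ≡ + 0
qPow-*ₚ-> {a} {N} f N<a = trans (*ₚ-coeff (qPow a) f N) (∑-qPow-≥ (λ i → f (N ∸ i)) N<a)

*ₚ-cong : ∀ {f f′ g g′} → f ≗ f′ → g ≗ g′ → f *ₚ g ≗ f′ *ₚ g′
*ₚ-cong {f} {f′} {g} {g′} f≗f′ g≗g′ N = begin
  (f *ₚ g) N
    ≡⟨ *ₚ-coeff f g N ⟩
  ℤ∑.∑ (suc N) (λ i → f i *ᶻ g (N ∸ i))
    ≡⟨ ℤ∑.∑-cong-≗ (suc N) (λ i → cong₂ _*ᶻ_ (f≗f′ i) (g≗g′ (N ∸ i))) ⟩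
  ℤ∑.∑ (suc N) (λ i → f′ i *ᶻ g′ (N ∸ i))
    ≡⟨ *ₚ-coeff f′ g′ N ⟨
  (f′ *ₚ g′) N
    ∎
  where open ≡-Reasoning

*ₚ-comm : ∀ f g → f *ₚ g ≗ g *ₚ f
*ₚ-comm f g N = begin
  (f *ₚ g) N                                         ≡⟨ *ₚ-coeff f g N ⟩
  ℤ∑.∑ (suc N) (λ i → f i *ᶻ g (N ∸ i))             ≡⟨ ℤ∑.∑-reverse (suc N) (λ i → f i *ᶻ g (N ∸ i)) ⟩
  ℤ∑.∑ (suc N) (λ i → f (N ∸ i) *ᶻ g (N ∸ (N ∸ i))) ≡⟨ ℤ∑.∑-cong (suc N) swap ⟩
  ℤ∑.∑ (suc N) (λ i → g i *ᶻ f (N ∸ i))             ≡⟨ *ₚ-coeff g f N ⟨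
  (g *ₚ f) N                                         ∎
  where
  open ≡-Reasoning
  swap : ∀ i → i < suc N → f (N ∸ i) *ᶻ g (N ∸ (N ∸ i)) ≡ g i *ᶻ f (N ∸ i)
  swap i i≤N = trans (cong (λ j → f (N ∸ i) *ᶻ g j) (ℕP.m∸[m∸n]≡n (ℕP.≤-pred i≤N))) (ℤP.*-comm (f (N ∸ i)) (g i))

*ₚ-distribˡ : ∀ f g h → f *ₚ (g +ₚ h) ≗ f *ₚ g +ₚ f *ₚ h
*ₚ-distribˡ f g h N = begin
  (f *ₚ (g +ₚ h)) N
    ≡⟨ *ₚ-coeff f (g +ₚ h) N ⟩
  ℤ∑.∑ (suc N) (λ i → f i *ᶻ (g +ₚ h) (N ∸ i))
    ≡⟨ ℤ∑.∑-cong-≗ (suc N) (λ i → ℤP.*-distribˡ-+ (f i) (g (N ∸ i)) (h (N ∸ i))) ⟩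
  ℤ∑.∑ (suc N) (λ i → f i *ᶻ g (N ∸ i) +ᶻ f i *ᶻ h (N ∸ i))
    ≡⟨ ℤ∑.∑-distrib-+ (suc N) (λ i → f i *ᶻ g (N ∸ i)) (λ i → f i *ᶻ h (N ∸ i)) ⟩
  ℤ∑.∑ (suc N) (λ i → f i *ᶻ g (N ∸ i)) +ᶻ ℤ∑.∑ (suc N) (λ i → f i *ᶻ h (N ∸ i))
    ≡⟨ cong₂ _+ᶻ_ (*ₚ-coeff f g N) (*ₚ-coeff f h N) ⟨
  (f *ₚ g +ₚ f *ₚ h) N
    ∎
  where open ≡-Reasoning

*ₚ-identityˡ : ∀ f → 1ₚ *ₚ f ≗ f
*ₚ-identityˡ f N = qPow-*ₚ-≤ f z≤n

*ₚ-distribʳ : ∀ f g h → (g +ₚ h) *ₚ f ≗ g *ₚ f +ₚ h *ₚ f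
*ₚ-distribʳ f g h N =
  trans (*ₚ-comm (g +ₚ h) f N) (trans (*ₚ-distribˡ f g h N) (cong₂ _+ᶻ_ (*ₚ-comm f g N) (*ₚ-comm f h N)))

infixl 7 _·ₚ_
_·ₚ_ : ℤ → PS → PS
(c ·ₚ f) N = c *ᶻ f N

·ₚ-*ₚ-assoc : ∀ c f g → (c ·ₚ f) *ₚ g ≗ c ·ₚ (f *ₚ g)
·ₚ-*ₚ-assoc c f g N = begin
  ((c ·ₚ f) *ₚ g) N
    ≡⟨ *ₚ-coeff (c ·ₚ f) g N ⟩
  ℤ∑.∑ (suc N) (λ i → c *ᶻ f i *ᶻ g (N ∸ i))
    ≡⟨ ℤ∑.∑-cong-≗ (suc N) (λ i → ℤP.*-assoc c (f i) (g (N ∸ i))) ⟩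
  ℤ∑.∑ (suc N) (λ i → c *ᶻ (f i *ᶻ g (N ∸ i)))
    ≡⟨ ℤ∑.*-distribˡ-∑ (suc N) c (λ i → f i *ᶻ g (N ∸ i)) ⟨
  c *ᶻ ℤ∑.∑ (suc N) (λ i → f i *ᶻ g (N ∸ i))
    ≡⟨ cong (c *ᶻ_) (*ₚ-coeff f g N) ⟨
  (c ·ₚ (f *ₚ g)) N
    ∎
  where open ≡-Reasoning

*ₚ-assoc : ∀ f g h → (f *ₚ g) *ₚ h ≗ f *ₚ (g *ₚ h)
*ₚ-assoc f g h zero = begin
  ((f *ₚ g) *ₚ h) 0     ≡⟨ *ₚ-coeff-zero (f *ₚ g) h ⟩
  (f *ₚ g) 0 *ᶻ h 0     ≡⟨ cong (_*ᶻ h 0) (*ₚ-coeff-zero f g) ⟩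
  f 0 *ᶻ g 0 *ᶻ h 0     ≡⟨ ℤP.*-assoc (f 0) (g 0) (h 0) ⟩
  f 0 *ᶻ (g 0 *ᶻ h 0)   ≡⟨ cong (f 0 *ᶻ_) (*ₚ-coeff-zero g h) ⟨
  f 0 *ᶻ (g *ₚ h) 0     ≡⟨ *ₚ-coeff-zero f (g *ₚ h) ⟨
  (f *ₚ (g *ₚ h)) 0     ∎
  where open ≡-Reasoning
*ₚ-assoc f g h (suc N) = begin
  ((f *ₚ g) *ₚ h) (suc N)
    ≡⟨ *ₚ-coeff-suc (f *ₚ g) h N ⟩
  (f *ₚ g) 0 *ᶻ h (suc N) +ᶻ (((f *ₚ g) ∘ suc) *ₚ h) N
    ≡⟨ cong₂ _+ᶻ_ (cong (_*ᶻ h (suc N)) (*ₚ-coeff-zero f g))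
                  (*ₚ-cong {g = h} (*ₚ-coeff-suc f g) (λ _ → refl) N) ⟩
  f 0 *ᶻ g 0 *ᶻ h (suc N) +ᶻ ((f 0 ·ₚ (g ∘ suc) +ₚ (f ∘ suc) *ₚ g) *ₚ h) N
    ≡⟨ cong (f 0 *ᶻ g 0 *ᶻ h (suc N) +ᶻ_) (*ₚ-distribʳ h (f 0 ·ₚ (g ∘ suc)) ((f ∘ suc) *ₚ g) N) ⟩
  f 0 *ᶻ g 0 *ᶻ h (suc N) +ᶻ (((f 0 ·ₚ (g ∘ suc)) *ₚ h) N +ᶻ (((f ∘ suc) *ₚ g) *ₚ h) N)
    ≡⟨ cong₂ (λ x y → f 0 *ᶻ g 0 *ᶻ h (suc N) +ᶻ (x +ᶻ y))
             (·ₚ-*ₚ-assoc (f 0) (g ∘ suc) h N) (*ₚ-assoc (f ∘ suc) g h N) ⟩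
  f 0 *ᶻ g 0 *ᶻ h (suc N) +ᶻ (f 0 *ᶻ ((g ∘ suc) *ₚ h) N +ᶻ ((f ∘ suc) *ₚ (g *ₚ h)) N)
    ≡⟨ regroup (f 0) (g 0) (h (suc N)) (((g ∘ suc) *ₚ h) N) (((f ∘ suc) *ₚ (g *ₚ h)) N) ⟩
  f 0 *ᶻ (g 0 *ᶻ h (suc N) +ᶻ ((g ∘ suc) *ₚ h) N) +ᶻ ((f ∘ suc) *ₚ (g *ₚ h)) N
    ≡⟨ cong (λ x → f 0 *ᶻ x +ᶻ ((f ∘ suc) *ₚ (g *ₚ h)) N) (*ₚ-coeff-suc g h N) ⟨
  f 0 *ᶻ (g *ₚ h) (suc N) +ᶻ ((f ∘ suc) *ₚ (g *ₚ h)) N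
    ≡⟨ *ₚ-coeff-suc f (g *ₚ h) N ⟨
  (f *ₚ (g *ₚ h)) (suc N)
    ∎
  where
  open ≡-Reasoning
  regroup : ∀ a b c d e → a *ᶻ b *ᶻ c +ᶻ (a *ᶻ d +ᶻ e) ≡ a *ᶻ (b *ᶻ c +ᶻ d) +ᶻ e
  regroup = ℤ-Solver.solve-∀

PS-isCommutativeRing : IsCommutativeRing _≗_ _+ₚ_ _*ₚ_ -ₚ_ 0ₚ 1ₚ
PS-isCommutativeRing = record
  { isRing = record
    { +-isAbelianGroup = record
      { isGroup = record
        { isMonoid = record
          { isSemigroup = record
            { isMagma = record
              { isEquivalence = record
                { refl  = λ _ → refl
                ; sym   = λ f≗g N → ≡.sym (f≗g N)
                ; trans = λ f≗g g≗h N → trans (f≗g N) (g≗h N)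
                }
              ; ∙-cong = λ f≗f′ g≗g′ N → cong₂ _+ᶻ_ (f≗f′ N) (g≗g′ N)
              }
            ; assoc = λ f g h N → ℤP.+-assoc (f N) (g N) (h N)
            }
          ; identity = (λ f N → ℤP.+-identityˡ (f N)) , (λ f N → ℤP.+-identityʳ (f N))
          }
        ; inverse = (λ f N → ℤP.+-inverseˡ (f N)) , (λ f N → ℤP.+-inverseʳ (f N))
        ; ⁻¹-cong = λ f≗g N → cong -_ (f≗g N)
        }
      ; comm = λ f g N → ℤP.+-comm (f N) (g N)
      }
    ; *-cong     = *ₚ-cong
    ; *-assoc    = *ₚ-assoc
    ; *-identity = *ₚ-identityˡ , (λ f N → trans (*ₚ-comm f 1ₚ N) (*ₚ-identityˡ f N))
    ; distrib    = *ₚ-distribˡ , *ₚ-distribʳ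
    }
  ; *-comm = *ₚ-comm
  }

PS-commutativeRing : CommutativeRing _ _
PS-commutativeRing = record { isCommutativeRing = PS-isCommutativeRing }

open CommutativeRing PS-commutativeRing
  using (+-assoc; +-comm; *-assoc; *-comm; *-identityʳ; zeroˡ; zeroʳ; distribʳ)
  renaming (refl to ≗-refl; sym to ≗-sym; trans to ≗-trans; +-cong to +ₚ-cong; -‿cong to -ₚ-cong)

*ₚ-congˡ : ∀ f {g g′} → g ≗ g′ → f *ₚ g ≗ f *ₚ g′
*ₚ-congˡ f = *ₚ-cong {f} (λ _ → refl)

*ₚ-congʳ : ∀ {f f′} g → f ≗ f′ → f *ₚ g ≗ f′ *ₚ g
*ₚ-congʳ g f≗f′ = *ₚ-cong {g = g} f≗f′ (λ _ → refl)

+ₚ-congˡ : ∀ f {g g′} → g ≗ g′ → f +ₚ g ≗ f +ₚ g′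
+ₚ-congˡ f g≗g′ N = cong (f N +ᶻ_) (g≗g′ N)

+ₚ-congʳ : ∀ {f f′} g → f ≗ f′ → f +ₚ g ≗ f′ +ₚ g
+ₚ-congʳ g f≗f′ N = cong (_+ᶻ g N) (f≗f′ N)

-- 0 and 1 are sent to 0ₚ and 1ₚ themselves, so that the solver's constants
-- coincide definitionally with the series named in Defs.
const : ℤ → PS
const (+ 0) = 0ₚ
const (+ 1) = 1ₚ
const c     = c ·ₚ 1ₚ

const≗·ₚ1ₚ : ∀ c → const c ≗ c ·ₚ 1ₚ
const≗·ₚ1ₚ (+ 0)           N = ≡.sym (ℤP.*-zeroˡ (1ₚ N))
const≗·ₚ1ₚ (+ 1)           N = ≡.sym (ℤP.*-identityˡ (1ₚ N))
const≗·ₚ1ₚ (+ suc (suc _)) N = refl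
const≗·ₚ1ₚ ℤ.-[1+ _ ]      N = refl

const-homomorphism : ℤ.+-*-rawRing ACR.-Raw-AlmostCommutative⟶ ACR.fromCommutativeRing PS-commutativeRing
const-homomorphism = record
  { ⟦_⟧    = const
  ; +-homo = λ a b N → trans (const≗·ₚ1ₚ (a +ᶻ b) N)
                       (trans (ℤP.*-distribʳ-+ (1ₚ N) a b)
                              (≡.sym (cong₂ _+ᶻ_ (const≗·ₚ1ₚ a N) (const≗·ₚ1ₚ b N))))
  ; *-homo = λ a b N → trans (const≗·ₚ1ₚ (a *ᶻ b) N)
                       (trans (ℤP.*-assoc a b (1ₚ N))
                       (≡.sym (trans (*ₚ-cong (const≗·ₚ1ₚ a) (const≗·ₚ1ₚ b) N)
                              (trans (·ₚ-*ₚ-assoc a 1ₚ (b ·ₚ 1ₚ) N)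
                                     (cong (a *ᶻ_) (*ₚ-identityˡ (b ·ₚ 1ₚ) N))))))
  ; -‿homo = λ a N → trans (const≗·ₚ1ₚ (- a) N)
                     (trans (≡.sym (ℤP.neg-distribˡ-* a (1ₚ N))) (cong -_ (≡.sym (const≗·ₚ1ₚ a N))))
  ; 0-homo = λ _ → refl
  ; 1-homo = λ _ → refl
  }

const-≟ : ∀ a b → Maybe (const a ≗ const b)
const-≟ a b with a ℤ.≟ b
... | yes refl = just ≗-refl
... | no _     = nothing

open import Algebra.Solver.Ring ℤ.+-*-rawRing (ACR.fromCommutativeRing PS-commutativeRing) const-homomorphism const-≟
  using (solve; _:=_; _:+_; _:*_; _:-_; :-_; con)

open import Algebra.Properties.Ring (CommutativeRing.ring PS-commutativeRing) using (-‿distribˡ-*)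
open import Algebra.Properties.Group (CommutativeRing.+-group PS-commutativeRing) using () renaming (∙-cancelˡ to +ₚ-cancelˡ)

module PS∑ = FiniteSums (CommutativeRing.ring PS-commutativeRing)
open PS∑

infix 8 1-q^_
1-q^_ : ℕ → PS
1-q^ n = 1ₚ +ₚ (-ₚ qPow n)

qPow-*ₚ-suc : ∀ a f N → (qPow (suc a) *ₚ f) (suc N) ≡ (qPow a *ₚ f) N
qPow-*ₚ-suc a f N =
  trans (*ₚ-coeff-suc (qPow (suc a)) f N) (trans (ℤP.+-identityˡ _) (*ₚ-cong {g = f} (qPow-suc a) (λ _ → refl) N))

qPow-+ : ∀ a b → qPow a *ₚ qPow b ≗ qPow (a + b)
qPow-+ zero    b N       = *ₚ-identityˡ (qPow b) N
qPow-+ (suc a) b zero    = qPow-*ₚ-> {suc a} (qPow b) (s≤s z≤n)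
qPow-+ (suc a) b (suc N) = trans (qPow-*ₚ-suc a (qPow b) N) (trans (qPow-+ a b N) (≡.sym (qPow-suc (a + b) N)))

qPow-*ₚ-cancelˡ : ∀ e {g h} → qPow e *ₚ g ≗ qPow e *ₚ h → g ≗ h
qPow-*ₚ-cancelˡ e {g} {h} eg≗eh N = begin
  g N                     ≡⟨ cong g (ℕP.m+n∸n≡m N e) ⟨
  g (N + e ∸ e)           ≡⟨ qPow-*ₚ-≤ g (ℕP.m≤n+m e N) ⟨
  (qPow e *ₚ g) (N + e)   ≡⟨ eg≗eh (N + e) ⟩
  (qPow e *ₚ h) (N + e)   ≡⟨ qPow-*ₚ-≤ h (ℕP.m≤n+m e N) ⟩
  h (N + e ∸ e)           ≡⟨ cong h (ℕP.m+n∸n≡m N e) ⟩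
  h N                     ∎
  where open ≡-Reasoning

infix 4 _≗[≤_]_
_≗[≤_]_ : PS → ℕ → PS → Set
f ≗[≤ N ] g = ∀ i → i ≤ N → f i ≡ g i

*ₚ-cong-≤ : ∀ {f f′ g g′ N} → f ≗[≤ N ] f′ → g ≗[≤ N ] g′ → f *ₚ g ≗[≤ N ] f′ *ₚ g′
*ₚ-cong-≤ {f} {f′} {g} {g′} f≗f′ g≗g′ i i≤N = begin
  (f *ₚ g) i                                 ≡⟨ *ₚ-coeff f g i ⟩
  ℤ∑.∑ (suc i) (λ j → f j *ᶻ g (i ∸ j))      ≡⟨ ℤ∑.∑-cong (suc i) (λ j j≤i → cong₂ _*ᶻ_
                                                  (f≗f′ j (ℕP.≤-trans (ℕP.≤-pred j≤i) i≤N))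
                                                  (g≗g′ (i ∸ j) (ℕP.≤-trans (ℕP.m∸n≤m i j) i≤N))) ⟩
  ℤ∑.∑ (suc i) (λ j → f′ j *ᶻ g′ (i ∸ j))    ≡⟨ *ₚ-coeff f′ g′ i ⟨
  (f′ *ₚ g′) i                               ∎
  where open ≡-Reasoning

*ₚ-cancelˡ-unit : ∀ f {g h} → f 0 ≡ + 1 → f *ₚ g ≗ f *ₚ h → g ≗ h
*ₚ-cancelˡ-unit f {g} {h} f₀≡1 fg≗fh N = agree N N ℕP.≤-refl
  where
  f₀* : ∀ x → f 0 *ᶻ x ≡ x
  f₀* x = trans (cong (_*ᶻ x) f₀≡1) (ℤP.*-identityˡ x)
  agree : ∀ N → g ≗[≤ N ] h
  agree zero    zero    _ = begin
    g 0               ≡⟨ f₀* (g 0) ⟨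
    f 0 *ᶻ g 0        ≡⟨ *ₚ-coeff-zero f g ⟨
    (f *ₚ g) 0        ≡⟨ fg≗fh 0 ⟩
    (f *ₚ h) 0        ≡⟨ *ₚ-coeff-zero f h ⟩
    f 0 *ᶻ h 0        ≡⟨ f₀* (h 0) ⟩
    h 0               ∎
    where open ≡-Reasoning
  agree (suc N) i i≤1+N with ℕP.m≤n⇒m<n∨m≡n i≤1+N
  ... | inj₁ i≤N   = agree N i (ℕP.≤-pred i≤N)
  ... | inj₂ refl  = ∙-cancelʳ tail (g (suc N)) (h (suc N)) (begin
    g (suc N) +ᶻ tail
      ≡⟨ cong₂ _+ᶻ_ (f₀* (g (suc N))) (*ₚ-cong-≤ {f ∘ suc} (λ _ _ → refl) (agree N) N ℕP.≤-refl) ⟨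
    f 0 *ᶻ g (suc N) +ᶻ ((f ∘ suc) *ₚ g) N
      ≡⟨ *ₚ-coeff-suc f g N ⟨
    (f *ₚ g) (suc N)
      ≡⟨ fg≗fh (suc N) ⟩
    (f *ₚ h) (suc N)
      ≡⟨ *ₚ-coeff-suc f h N ⟩
    f 0 *ᶻ h (suc N) +ᶻ tail
      ≡⟨ cong (_+ᶻ tail) (f₀* (h (suc N))) ⟩
    h (suc N) +ᶻ tail
      ∎)
    where
    open ≡-Reasoning
    tail = ((f ∘ suc) *ₚ h) N

1-q^-cancelˡ : ∀ n {g h} → 1-q^ suc n *ₚ g ≗ 1-q^ suc n *ₚ h → g ≗ h
1-q^-cancelˡ n = *ₚ-cancelˡ-unit (1-q^ suc n) refl

geomInv-mod : ∀ d N → geomInv d N ≡ 1ₚ (N % suc d)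
geomInv-mod d N with N % suc d
... | zero  = refl
... | suc _ = refl

geomInv-inverse : ∀ d → geomInv d *ₚ 1-q^ suc d ≗ 1ₚ
geomInv-inverse d N = trans (expand N) (coeff N)
  where
  g = geomInv d
  k = suc d
  expand : g *ₚ 1-q^ k ≗ g +ₚ (-ₚ (qPow k *ₚ g))
  expand = solve 2 (λ g q → g :* (con (+ 1) :- q) := g :- q :* g) ≗-refl g (qPow k)
  coeff : ∀ N → g N +ᶻ - (qPow k *ₚ g) N ≡ 1ₚ N
  coeff N with k ℕ.≤? N
  ... | yes k≤N = begin
    g N +ᶻ - (qPow k *ₚ g) N             ≡⟨ cong (λ x → g N +ᶻ - x) (qPow-*ₚ-≤ g k≤N) ⟩
    g N +ᶻ - g (N ∸ k)                   ≡⟨ cong₂ (λ x y → x +ᶻ - y) (geomInv-mod d N) (geomInv-mod d (N ∸ k)) ⟩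
    1ₚ (N % k) +ᶻ - 1ₚ ((N ∸ k) % k)     ≡⟨ cong (λ m → 1ₚ (m % k) +ᶻ - 1ₚ ((N ∸ k) % k)) (ℕP.m∸n+n≡m k≤N) ⟨
    1ₚ ((N ∸ k + k) % k) +ᶻ - 1ₚ ((N ∸ k) % k)
                                         ≡⟨ cong (λ m → 1ₚ m +ᶻ - 1ₚ ((N ∸ k) % k)) ([m+n]%n≡m%n (N ∸ k) k) ⟩
    1ₚ ((N ∸ k) % k) +ᶻ - 1ₚ ((N ∸ k) % k) ≡⟨ ℤP.+-inverseʳ (1ₚ ((N ∸ k) % k)) ⟩
    + 0                                  ≡⟨ qPow-off (ℕP.<⇒≢ (ℕP.<-≤-trans (s≤s z≤n) k≤N)) ⟨
    1ₚ N                                 ∎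
    where open ≡-Reasoning
  ... | no k≰N = begin
    g N +ᶻ - (qPow k *ₚ g) N             ≡⟨ cong (λ x → g N +ᶻ - x) (qPow-*ₚ-> g (ℕP.≰⇒> k≰N)) ⟩
    g N +ᶻ + 0                           ≡⟨ ℤP.+-identityʳ (g N) ⟩
    g N                                  ≡⟨ geomInv-mod d N ⟩
    1ₚ (N % k)                           ≡⟨ cong 1ₚ (m<n⇒m%n≡m (ℕP.≰⇒> k≰N)) ⟩
    1ₚ N                                 ∎
    where open ≡-Reasoning

open import Relation.Binary.Reasoning.Setoid (CommutativeRing.setoid PS-commutativeRing)

invPoch-suc : ∀ n → 1-q^ suc n *ₚ invPoch (suc n) ≗ invPoch n
invPoch-suc n = begin
  1-q^ suc n *ₚ (invPoch n *ₚ geomInv n)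
    ≈⟨ solve 3 (λ o a g → o :* (a :* g) := a :* (g :* o)) ≗-refl (1-q^ suc n) (invPoch n) (geomInv n) ⟩
  invPoch n *ₚ (geomInv n *ₚ 1-q^ suc n)
    ≈⟨ *ₚ-congˡ (invPoch n) (geomInv-inverse n) ⟩
  invPoch n *ₚ 1ₚ
    ≈⟨ *-identityʳ (invPoch n) ⟩
  invPoch n
    ∎

poch*invPoch : ∀ n → poch n *ₚ invPoch n ≗ 1ₚ
poch*invPoch zero    = *ₚ-identityˡ 1ₚ
poch*invPoch (suc n) = begin
  poch n *ₚ 1-q^ suc n *ₚ invPoch (suc n)  ≈⟨ *-assoc (poch n) (1-q^ suc n) (invPoch (suc n)) ⟩
  poch n *ₚ (1-q^ suc n *ₚ invPoch (suc n)) ≈⟨ *ₚ-congˡ (poch n) (invPoch-suc n) ⟩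
  poch n *ₚ invPoch n                      ≈⟨ poch*invPoch n ⟩
  1ₚ                                       ∎

sign-+ : ∀ a b → sign (a + b) ≗ sign a *ₚ sign b
sign-+ zero    b = ≗-sym (*ₚ-identityˡ (sign b))
sign-+ (suc a) b = ≗-trans (-ₚ-cong (sign-+ a b)) (-‿distribˡ-* (sign a) (sign b))

sign*sign : ∀ a → sign a *ₚ sign a ≗ 1ₚ
sign*sign zero    = *ₚ-identityˡ 1ₚ
sign*sign (suc a) = ≗-trans (solve 1 (λ x → (:- x) :* (:- x) := x :* x) ≗-refl (sign a)) (sign*sign a)

-- q-binomial coefficients and the q-Pascal rules

1-q^-+ : ∀ m n → 1-q^ (m + n) ≗ 1-q^ m +ₚ qPow m *ₚ 1-q^ n
1-q^-+ m n = begin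
  1ₚ +ₚ (-ₚ qPow (m + n))          ≈⟨ +ₚ-congˡ 1ₚ (-ₚ-cong (≗-sym (qPow-+ m n))) ⟩
  1ₚ +ₚ (-ₚ (qPow m *ₚ qPow n))    ≈⟨ solve 2 (λ x y → con (+ 1) :- x :* y := (con (+ 1) :- x) :+ x :* (con (+ 1) :- y))
                                            ≗-refl (qPow m) (qPow n) ⟩
  1-q^ m +ₚ qPow m *ₚ 1-q^ n       ∎

invPoch-pascal : ∀ m n → 1-q^ (suc m + suc n) *ₚ (invPoch (suc m) *ₚ invPoch (suc n))
                         ≗ invPoch m *ₚ invPoch (suc n) +ₚ qPow (suc m) *ₚ (invPoch (suc m) *ₚ invPoch n)
invPoch-pascal m n = begin
  1-q^ (suc m + suc n) *ₚ (Iₘ₊₁ *ₚ Iₙ₊₁)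
    ≈⟨ *ₚ-congʳ (Iₘ₊₁ *ₚ Iₙ₊₁) (1-q^-+ (suc m) (suc n)) ⟩
  (1-q^ suc m +ₚ qPow (suc m) *ₚ 1-q^ suc n) *ₚ (Iₘ₊₁ *ₚ Iₙ₊₁)
    ≈⟨ solve 5 (λ a x b I J → (a :+ x :* b) :* (I :* J) := (a :* I) :* J :+ x :* (I :* (b :* J)))
             ≗-refl (1-q^ suc m) (qPow (suc m)) (1-q^ suc n) Iₘ₊₁ Iₙ₊₁ ⟩
  (1-q^ suc m *ₚ Iₘ₊₁) *ₚ Iₙ₊₁ +ₚ qPow (suc m) *ₚ (Iₘ₊₁ *ₚ (1-q^ suc n *ₚ Iₙ₊₁))
    ≈⟨ +ₚ-cong (*ₚ-congʳ Iₙ₊₁ (invPoch-suc m)) (*ₚ-congˡ (qPow (suc m)) (*ₚ-congˡ Iₘ₊₁ (invPoch-suc n))) ⟩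
  invPoch m *ₚ Iₙ₊₁ +ₚ qPow (suc m) *ₚ (Iₘ₊₁ *ₚ invPoch n)
    ∎
  where
  Iₘ₊₁ = invPoch (suc m)
  Iₙ₊₁ = invPoch (suc n)

invPochDiff-≤ : ∀ {L j} → j ≤ L → invPochDiff L j ≡ invPoch (L ∸ j)
invPochDiff-≤ {L} {j} j≤L with j ℕ.≤? L
... | yes _  = refl
... | no j≰L = ⊥-elim (j≰L j≤L)

invPochDiff-> : ∀ {L j} → L < j → invPochDiff L j ≡ 0ₚ
invPochDiff-> {L} {j} L<j with j ℕ.≤? L
... | yes j≤L = ⊥-elim (ℕP.<⇒≱ L<j j≤L)
... | no _    = refl

invPochDiff-suc : ∀ L j → invPochDiff (suc L) (suc j) ≡ invPochDiff L j
invPochDiff-suc L j with j ℕ.≤? L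
... | yes j≤L = invPochDiff-≤ (s≤s j≤L)
... | no j≰L  = invPochDiff-> (s≤s (ℕP.≰⇒> j≰L))

invPochDiff-+ : ∀ k L j → invPochDiff (k + L) (k + j) ≡ invPochDiff L j
invPochDiff-+ zero    L j = refl
invPochDiff-+ (suc k) L j = trans (invPochDiff-suc (k + L) (k + j)) (invPochDiff-+ k L j)

invPochDiff-shift : ∀ {L r} s → r ≤ L → invPochDiff L (r + s) ≡ invPochDiff (L ∸ r) s
invPochDiff-shift {L} {r} s r≤L =
  trans (cong (λ n → invPochDiff n (r + s)) (≡.sym (ℕP.m+[n∸m]≡n r≤L))) (invPochDiff-+ r (L ∸ r) s)

invPochDiff-diag : ∀ L → invPochDiff L L ≡ 1ₚ
invPochDiff-diag L = trans (invPochDiff-≤ {L} ℕP.≤-refl) (cong invPoch (ℕP.n∸n≡0 L))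

-- qbin a s = [a choose s]_q / (q)_a = 1 / ((q)_{a-s} (q)_s), and 0 for s > a.
qbin : ℕ → ℕ → PS
qbin a s = invPochDiff a s *ₚ invPoch s

qbin-split : ∀ {a} s t → a ≡ s + t → qbin a s ≗ invPoch t *ₚ invPoch s
qbin-split s t refl = *ₚ-congʳ (invPoch s) (cong-app (trans (invPochDiff-≤ {s + t} (ℕP.m≤m+n s t)) (cong invPoch (ℕP.m+n∸m≡n s t))))

qbin-diag : ∀ a → qbin a a ≗ invPoch a
qbin-diag a = ≗-trans (*ₚ-congʳ (invPoch a) (cong-app (invPochDiff-diag a))) (*ₚ-identityˡ (invPoch a))

qbin-> : ∀ {a s} → a < s → qbin a s ≗ 0ₚ
qbin-> {a} {s} a<s = ≗-trans (*ₚ-congʳ (invPoch s) (cong-app (invPochDiff-> a<s))) (zeroˡ (invPoch s))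

qbin-pascal₀ : ∀ a → 1-q^ suc a *ₚ qbin (suc a) 0 ≗ qbin a 0
qbin-pascal₀ a = begin
  1-q^ suc a *ₚ (invPoch (suc a) *ₚ 1ₚ)   ≈⟨ *ₚ-congˡ (1-q^ suc a) (*-identityʳ (invPoch (suc a))) ⟩
  1-q^ suc a *ₚ invPoch (suc a)           ≈⟨ invPoch-suc a ⟩
  invPoch a                               ≈⟨ *-identityʳ (invPoch a) ⟨
  invPoch a *ₚ 1ₚ                         ∎

qbin-pascal : ∀ a s → 1-q^ suc a *ₚ qbin (suc a) (suc s) ≗ qbin a (suc s) +ₚ qPow (a ∸ s) *ₚ qbin a s
qbin-pascal a s with ℕ.compare s a
... | less .s t = begin
  1-q^ suc (suc (s + t)) *ₚ qbin (suc (suc (s + t))) (suc s)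
    ≈⟨ *ₚ-cong (cong-app (cong 1-q^_ (2+s+t≡1+t+1+s s t))) (qbin-split (suc s) (suc t) (cong suc (≡.sym (ℕP.+-suc s t)))) ⟩
  1-q^ (suc t + suc s) *ₚ (invPoch (suc t) *ₚ invPoch (suc s))
    ≈⟨ invPoch-pascal t s ⟩
  invPoch t *ₚ invPoch (suc s) +ₚ qPow (suc t) *ₚ (invPoch (suc t) *ₚ invPoch s)
    ≈⟨ +ₚ-cong (qbin-split (suc s) t refl)
               (*ₚ-cong (cong-app (cong qPow (1+s+t∸s≡1+t s t))) (qbin-split s (suc t) (≡.sym (ℕP.+-suc s t)))) ⟨
  qbin (suc (s + t)) (suc s) +ₚ qPow (suc (s + t) ∸ s) *ₚ qbin (suc (s + t)) s
    ∎
  where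
  2+s+t≡1+t+1+s : ∀ s t → suc (suc (s + t)) ≡ suc t + suc s
  2+s+t≡1+t+1+s = ℕ-Solver.solve-∀
  1+s+t∸s≡1+t : ∀ s t → suc (s + t) ∸ s ≡ suc t
  1+s+t∸s≡1+t s t = trans (cong (_∸ s) (≡.sym (ℕP.+-suc s t))) (ℕP.m+n∸m≡n s (suc t))
... | equal .s = begin
  1-q^ suc s *ₚ qbin (suc s) (suc s)           ≈⟨ *ₚ-congˡ (1-q^ suc s) (qbin-diag (suc s)) ⟩
  1-q^ suc s *ₚ invPoch (suc s)                ≈⟨ invPoch-suc s ⟩
  invPoch s                                    ≈⟨ solve 1 (λ x → x := con (+ 0) :+ con (+ 1) :* x) ≗-refl (invPoch s) ⟩
  0ₚ +ₚ 1ₚ *ₚ invPoch s                        ≈⟨ +ₚ-cong (qbin-> (ℕP.n<1+n s))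
                                                          (*ₚ-cong (cong-app (cong qPow (ℕP.n∸n≡0 s))) (qbin-diag s)) ⟨
  qbin s (suc s) +ₚ qPow (s ∸ s) *ₚ qbin s s   ∎
... | greater .a t = begin
  1-q^ suc a *ₚ qbin (suc a) (suc s)
    ≈⟨ *ₚ-congˡ (1-q^ suc a) (qbin-> (s≤s s>a)) ⟩
  1-q^ suc a *ₚ 0ₚ
    ≈⟨ solve 2 (λ x y → x :* con (+ 0) := con (+ 0) :+ y :* con (+ 0)) ≗-refl (1-q^ suc a) (qPow (a ∸ s)) ⟩
  0ₚ +ₚ qPow (a ∸ s) *ₚ 0ₚ
    ≈⟨ +ₚ-cong (qbin-> (ℕP.m<n⇒m<1+n s>a)) (*ₚ-congˡ (qPow (a ∸ s)) (qbin-> s>a)) ⟨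
  qbin a (suc s) +ₚ qPow (a ∸ s) *ₚ qbin a s
    ∎
  where
  s>a : a < suc (a + t)
  s>a = s≤s (ℕP.m≤m+n a t)

qbin-pascal′ : ∀ a s → 1-q^ suc a *ₚ qbin (suc a) (suc s) ≗ qPow (suc s) *ₚ qbin a (suc s) +ₚ qbin a s
qbin-pascal′ a s with ℕ.compare s a
... | less .s t = begin
  1-q^ suc (suc (s + t)) *ₚ qbin (suc (suc (s + t))) (suc s)
    ≈⟨ *ₚ-cong (cong-app (cong 1-q^_ 2+s+t≡1+s+1+t)) (qbin-split (suc s) (suc t) 2+s+t≡1+s+1+t) ⟩
  1-q^ (suc s + suc t) *ₚ (invPoch (suc t) *ₚ invPoch (suc s))
    ≈⟨ *ₚ-congˡ (1-q^ (suc s + suc t)) (*-comm (invPoch (suc t)) (invPoch (suc s))) ⟩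
  1-q^ (suc s + suc t) *ₚ (invPoch (suc s) *ₚ invPoch (suc t))
    ≈⟨ invPoch-pascal s t ⟩
  invPoch s *ₚ invPoch (suc t) +ₚ qPow (suc s) *ₚ (invPoch (suc s) *ₚ invPoch t)
    ≈⟨ solve 5 (λ a b x c d → a :* b :+ x :* (c :* d) := x :* (d :* c) :+ b :* a) ≗-refl
               (invPoch s) (invPoch (suc t)) (qPow (suc s)) (invPoch (suc s)) (invPoch t) ⟩
  qPow (suc s) *ₚ (invPoch t *ₚ invPoch (suc s)) +ₚ invPoch (suc t) *ₚ invPoch s
    ≈⟨ +ₚ-cong (*ₚ-congˡ (qPow (suc s)) (qbin-split (suc s) t refl)) (qbin-split s (suc t) (≡.sym (ℕP.+-suc s t))) ⟨
  qPow (suc s) *ₚ qbin (suc (s + t)) (suc s) +ₚ qbin (suc (s + t)) s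
    ∎
  where
  2+s+t≡1+s+1+t : suc (suc (s + t)) ≡ suc s + suc t
  2+s+t≡1+s+1+t = cong suc (≡.sym (ℕP.+-suc s t))
... | equal .s = begin
  1-q^ suc s *ₚ qbin (suc s) (suc s)           ≈⟨ *ₚ-congˡ (1-q^ suc s) (qbin-diag (suc s)) ⟩
  1-q^ suc s *ₚ invPoch (suc s)                ≈⟨ invPoch-suc s ⟩
  invPoch s                                    ≈⟨ solve 2 (λ x q → x := q :* con (+ 0) :+ x) ≗-refl (invPoch s) (qPow (suc s)) ⟩
  qPow (suc s) *ₚ 0ₚ +ₚ invPoch s              ≈⟨ +ₚ-cong (*ₚ-congˡ (qPow (suc s)) (qbin-> (ℕP.n<1+n s))) (qbin-diag s) ⟨
  qPow (suc s) *ₚ qbin s (suc s) +ₚ qbin s s   ∎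
... | greater .a t = begin
  1-q^ suc a *ₚ qbin (suc a) (suc s)
    ≈⟨ *ₚ-congˡ (1-q^ suc a) (qbin-> (s≤s s>a)) ⟩
  1-q^ suc a *ₚ 0ₚ
    ≈⟨ solve 2 (λ x q → x :* con (+ 0) := q :* con (+ 0) :+ con (+ 0)) ≗-refl (1-q^ suc a) (qPow (suc s)) ⟩
  qPow (suc s) *ₚ 0ₚ +ₚ 0ₚ
    ≈⟨ +ₚ-cong (*ₚ-congˡ (qPow (suc s)) (qbin-> (ℕP.m<n⇒m<1+n s>a))) (qbin-> s>a) ⟨
  qPow (suc s) *ₚ qbin a (suc s) +ₚ qbin a s
    ∎
  where
  s>a : a < suc (a + t)
  s>a = s≤s (ℕP.m≤m+n a t)

-- The q-Pfaff–Saalschütz sum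

-- The s-th term of the q-Pfaff–Saalschütz sum: q^{s² + sc} w(s) / ((q)_{a-s} (q)_s (q)_{c+s}),
-- where the weight w(s) is 1/(q)_{b-s} for the sum itself and 1 for its limit b → ∞.
saalschützTerm : ℕ → ℕ → (ℕ → PS) → ℕ → PS
saalschützTerm a c w s = qPow (s * s + s * c) *ₚ qbin a s *ₚ w s *ₚ invPoch (c + s)

saalschützTerm-pascal₀ : ∀ a c w → 1-q^ suc a *ₚ saalschützTerm (suc a) c w 0 ≗ saalschützTerm a c w 0
saalschützTerm-pascal₀ a c w = begin
  1-q^ suc a *ₚ (qPow 0 *ₚ qbin (suc a) 0 *ₚ w 0 *ₚ invPoch (c + 0))
    ≈⟨ solve 5 (λ o x b v i → o :* (x :* b :* v :* i) := x :* (o :* b) :* v :* i) ≗-refl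
               (1-q^ suc a) (qPow 0) (qbin (suc a) 0) (w 0) (invPoch (c + 0)) ⟩
  qPow 0 *ₚ (1-q^ suc a *ₚ qbin (suc a) 0) *ₚ w 0 *ₚ invPoch (c + 0)
    ≈⟨ *ₚ-congʳ (invPoch (c + 0)) (*ₚ-congʳ (w 0) (*ₚ-congˡ (qPow 0) (qbin-pascal₀ a))) ⟩
  qPow 0 *ₚ qbin a 0 *ₚ w 0 *ₚ invPoch (c + 0)
    ∎

saalschützTerm-pascal : ∀ a c w t → t ≤ a →
  1-q^ suc a *ₚ saalschützTerm (suc a) c w (suc t)
    ≗ saalschützTerm a c w (suc t) +ₚ qPow (suc (a + c)) *ₚ saalschützTerm a (suc c) (w ∘ suc) t
saalschützTerm-pascal a c w t t≤a = begin
  1-q^ suc a *ₚ (qPow e₁ *ₚ qbin (suc a) (suc t) *ₚ w (suc t) *ₚ invPoch (c + suc t))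
    ≈⟨ solve 5 (λ o x b v i → o :* (x :* b :* v :* i) := x :* (o :* b) :* v :* i) ≗-refl
               (1-q^ suc a) (qPow e₁) (qbin (suc a) (suc t)) (w (suc t)) (invPoch (c + suc t)) ⟩
  qPow e₁ *ₚ (1-q^ suc a *ₚ qbin (suc a) (suc t)) *ₚ w (suc t) *ₚ invPoch (c + suc t)
    ≈⟨ *ₚ-congʳ (invPoch (c + suc t)) (*ₚ-congʳ (w (suc t)) (*ₚ-congˡ (qPow e₁) (qbin-pascal a t))) ⟩
  qPow e₁ *ₚ (qbin a (suc t) +ₚ qPow (a ∸ t) *ₚ qbin a t) *ₚ w (suc t) *ₚ invPoch (c + suc t)
    ≈⟨ solve 6 (λ x b₁ y b₀ v i → x :* (b₁ :+ y :* b₀) :* v :* i := x :* b₁ :* v :* i :+ (x :* y) :* b₀ :* v :* i) ≗-refl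
               (qPow e₁) (qbin a (suc t)) (qPow (a ∸ t)) (qbin a t) (w (suc t)) (invPoch (c + suc t)) ⟩
  saalschützTerm a c w (suc t) +ₚ (qPow e₁ *ₚ qPow (a ∸ t)) *ₚ qbin a t *ₚ w (suc t) *ₚ invPoch (c + suc t)
    ≈⟨ +ₚ-congˡ (saalschützTerm a c w (suc t))
         (*ₚ-cong (*ₚ-congʳ (w (suc t)) (*ₚ-congʳ (qbin a t) exponent)) (cong-app (cong invPoch (ℕP.+-suc c t)))) ⟩
  saalschützTerm a c w (suc t) +ₚ (qPow (suc (a + c)) *ₚ qPow e₀) *ₚ qbin a t *ₚ w (suc t) *ₚ invPoch (suc c + t)
    ≈⟨ +ₚ-congˡ (saalschützTerm a c w (suc t))
         (solve 5 (λ x y b v i → (x :* y) :* b :* v :* i := x :* (y :* b :* v :* i)) ≗-refl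
                (qPow (suc (a + c))) (qPow e₀) (qbin a t) (w (suc t)) (invPoch (suc c + t))) ⟩
  saalschützTerm a c w (suc t) +ₚ qPow (suc (a + c)) *ₚ saalschützTerm a (suc c) (w ∘ suc) t
    ∎
  where
  e₁ = suc t * suc t + suc t * c
  e₀ = t * t + t * suc c
  square-step : ∀ t c d → suc t * suc t + suc t * c + d ≡ suc (t + d + c) + (t * t + t * suc c)
  square-step = ℕ-Solver.solve-∀
  exponent : qPow e₁ *ₚ qPow (a ∸ t) ≗ qPow (suc (a + c)) *ₚ qPow e₀
  exponent = begin
    qPow e₁ *ₚ qPow (a ∸ t)          ≈⟨ qPow-+ e₁ (a ∸ t) ⟩
    qPow (e₁ + (a ∸ t))              ≡⟨ cong qPow (square-step t c (a ∸ t)) ⟩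
    qPow (suc (t + (a ∸ t) + c) + e₀) ≡⟨ cong (λ x → qPow (suc (x + c) + e₀)) (ℕP.m+[n∸m]≡n t≤a) ⟩
    qPow (suc (a + c) + e₀)          ≈⟨ qPow-+ (suc (a + c)) e₀ ⟨
    qPow (suc (a + c)) *ₚ qPow e₀    ∎

saalschütz-recurrence : ∀ a c w →
  1-q^ suc a *ₚ ∑ (suc (suc a)) (saalschützTerm (suc a) c w)
    ≗ ∑ (suc a) (saalschützTerm a c w) +ₚ qPow (suc (a + c)) *ₚ ∑ (suc a) (saalschützTerm a (suc c) (w ∘ suc))
saalschütz-recurrence a c w = begin
  1-q^ suc a *ₚ ∑ (suc (suc a)) T′
    ≈⟨ *-distribˡ-∑ (suc (suc a)) (1-q^ suc a) T′ ⟩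
  1-q^ suc a *ₚ T′ 0 +ₚ ∑[ t < suc a ] (1-q^ suc a *ₚ T′ (suc t))
    ≈⟨ +ₚ-cong (saalschützTerm-pascal₀ a c w) (∑-cong (suc a) (λ t t<1+a → saalschützTerm-pascal a c w t (ℕP.≤-pred t<1+a))) ⟩
  T 0 +ₚ ∑[ t < suc a ] (T (suc t) +ₚ x *ₚ U t)
    ≈⟨ +ₚ-congˡ (T 0) (∑-distrib-+ (suc a) (T ∘ suc) (λ t → x *ₚ U t)) ⟩
  T 0 +ₚ (∑ (suc a) (T ∘ suc) +ₚ ∑[ t < suc a ] (x *ₚ U t))
    ≈⟨ +-assoc (T 0) (∑ (suc a) (T ∘ suc)) (∑[ t < suc a ] (x *ₚ U t)) ⟨
  ∑ (suc (suc a)) T +ₚ ∑[ t < suc a ] (x *ₚ U t)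
    ≈⟨ +ₚ-cong (∑-truncate T (ℕP.n≤1+n (suc a)) beyond) (≗-sym (*-distribˡ-∑ (suc a) x U)) ⟩
  ∑ (suc a) T +ₚ x *ₚ ∑ (suc a) U
    ∎
  where
  T′ = saalschützTerm (suc a) c w
  T  = saalschützTerm a c w
  U  = saalschützTerm a (suc c) (w ∘ suc)
  x  = qPow (suc (a + c))
  beyond : ∀ s → suc a ≤ s → T s ≗ 0ₚ
  beyond s a<s = begin
    qPow (s * s + s * c) *ₚ qbin a s *ₚ w s *ₚ invPoch (c + s)
      ≈⟨ *ₚ-congʳ (invPoch (c + s)) (*ₚ-congʳ (w s) (*ₚ-congˡ (qPow (s * s + s * c)) (qbin-> a<s))) ⟩
    qPow (s * s + s * c) *ₚ 0ₚ *ₚ w s *ₚ invPoch (c + s)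
      ≈⟨ solve 3 (λ x v i → x :* con (+ 0) :* v :* i := con (+ 0)) ≗-refl (qPow (s * s + s * c)) (w s) (invPoch (c + s)) ⟩
    0ₚ ∎

invPoch-absorb : ∀ n → invPoch n +ₚ qPow (suc n) *ₚ invPoch (suc n) ≗ invPoch (suc n)
invPoch-absorb n = begin
  invPoch n +ₚ qPow (suc n) *ₚ invPoch (suc n)
    ≈⟨ +ₚ-congʳ (qPow (suc n) *ₚ invPoch (suc n)) (invPoch-suc n) ⟨
  1-q^ suc n *ₚ invPoch (suc n) +ₚ qPow (suc n) *ₚ invPoch (suc n)
    ≈⟨ solve 2 (λ x i → (con (+ 1) :- x) :* i :+ x :* i := i) ≗-refl (qPow (suc n)) (invPoch (suc n)) ⟩
  invPoch (suc n)
    ∎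

saalschütz∞ : ∀ a c → ∑ (suc a) (saalschützTerm a c (λ _ → 1ₚ)) ≗ invPoch a *ₚ invPoch (a + c)
saalschütz∞ zero c = begin
  qPow 0 *ₚ qbin 0 0 *ₚ 1ₚ *ₚ invPoch (c + 0) +ₚ 0ₚ
    ≈⟨ solve 1 (λ i → con (+ 1) :* (con (+ 1) :* con (+ 1)) :* con (+ 1) :* i :+ con (+ 0) := con (+ 1) :* i) ≗-refl
               (invPoch (c + 0)) ⟩
  1ₚ *ₚ invPoch (c + 0)
    ≡⟨ cong (λ n → 1ₚ *ₚ invPoch n) (ℕP.+-identityʳ c) ⟩
  1ₚ *ₚ invPoch c
    ∎
saalschütz∞ (suc a) c = 1-q^-cancelˡ a (begin
  1-q^ suc a *ₚ ∑ (suc (suc a)) (saalschützTerm (suc a) c (λ _ → 1ₚ))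
    ≈⟨ saalschütz-recurrence a c (λ _ → 1ₚ) ⟩
  ∑ (suc a) (saalschützTerm a c (λ _ → 1ₚ)) +ₚ x *ₚ ∑ (suc a) (saalschützTerm a (suc c) (λ _ → 1ₚ))
    ≈⟨ +ₚ-cong (saalschütz∞ a c) (*ₚ-congˡ x (saalschütz∞ a (suc c))) ⟩
  invPoch a *ₚ invPoch (a + c) +ₚ x *ₚ (invPoch a *ₚ invPoch (a + suc c))
    ≡⟨ cong (λ n → invPoch a *ₚ invPoch (a + c) +ₚ x *ₚ (invPoch a *ₚ invPoch n)) (ℕP.+-suc a c) ⟩
  invPoch a *ₚ invPoch (a + c) +ₚ x *ₚ (invPoch a *ₚ invPoch (suc (a + c)))
    ≈⟨ solve 4 (λ i j x k → i :* j :+ x :* (i :* k) := i :* (j :+ x :* k)) ≗-refl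
               (invPoch a) (invPoch (a + c)) x (invPoch (suc (a + c))) ⟩
  invPoch a *ₚ (invPoch (a + c) +ₚ x *ₚ invPoch (suc (a + c)))
    ≈⟨ *ₚ-cong (≗-sym (invPoch-suc a)) (invPoch-absorb (a + c)) ⟩
  (1-q^ suc a *ₚ invPoch (suc a)) *ₚ invPoch (suc (a + c))
    ≈⟨ *-assoc (1-q^ suc a) (invPoch (suc a)) (invPoch (suc (a + c))) ⟩
  1-q^ suc a *ₚ (invPoch (suc a) *ₚ invPoch (suc a + c))
    ∎)
  where
  x = qPow (suc (a + c))

∑-saalschützTerm-cong : ∀ n a c {w w′ : ℕ → PS} → (∀ s → w s ≡ w′ s) →
  ∑ n (saalschützTerm a c w) ≗ ∑ n (saalschützTerm a c w′)
∑-saalschützTerm-cong n a c w≡w′ =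
  ∑-cong-≗ n (λ s → cong-app (cong (λ v → qPow (s * s + s * c) *ₚ qbin a s *ₚ v *ₚ invPoch (c + s)) (w≡w′ s)))

saalschützProduct : ℕ → ℕ → ℕ → PS
saalschützProduct a b c = poch (a + b + c) *ₚ invPoch a *ₚ invPoch b *ₚ invPoch (a + c) *ₚ invPoch (b + c)

saalschützCommon : ℕ → ℕ → ℕ → PS
saalschützCommon a b c =
  poch (suc (a + b + c)) *ₚ invPoch a *ₚ invPoch (suc b) *ₚ invPoch (suc (a + c)) *ₚ invPoch (suc (b + c))

saalschützProduct-sucᵇ : ∀ a b c → saalschützProduct a (suc b) c ≗ 1-q^ suc (a + c) *ₚ saalschützCommon a b c
saalschützProduct-sucᵇ a b c = begin
  poch (a + suc b + c) *ₚ A *ₚ B *ₚ invPoch (a + c) *ₚ E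
    ≡⟨ cong (λ m → poch m *ₚ A *ₚ B *ₚ invPoch (a + c) *ₚ E) (middle a b c) ⟩
  p *ₚ A *ₚ B *ₚ invPoch (a + c) *ₚ E
    ≈⟨ *ₚ-congʳ E (*ₚ-congˡ (p *ₚ A *ₚ B) (invPoch-suc (a + c))) ⟨
  p *ₚ A *ₚ B *ₚ (1-q^ suc (a + c) *ₚ C) *ₚ E
    ≈⟨ solve 6 (λ p A B o C E → p :* A :* B :* (o :* C) :* E := o :* (p :* A :* B :* C :* E)) ≗-refl
               p A B (1-q^ suc (a + c)) C E ⟩
  1-q^ suc (a + c) *ₚ saalschützCommon a b c
    ∎
  where
  p = poch (suc (a + b + c))
  A = invPoch a
  B = invPoch (suc b)
  C = invPoch (suc (a + c))
  E = invPoch (suc (b + c))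
  middle : ∀ a b c → a + suc b + c ≡ suc (a + b + c)
  middle = ℕ-Solver.solve-∀

saalschützProduct-sucᶜ : ∀ a b c → saalschützProduct a b (suc c) ≗ 1-q^ suc b *ₚ saalschützCommon a b c
saalschützProduct-sucᶜ a b c = begin
  poch (a + b + suc c) *ₚ A *ₚ invPoch b *ₚ invPoch (a + suc c) *ₚ invPoch (b + suc c)
    ≡⟨ cong₂ (λ m k → poch m *ₚ A *ₚ invPoch b *ₚ invPoch k *ₚ invPoch (b + suc c)) (ℕP.+-suc (a + b) c) (ℕP.+-suc a c) ⟩
  p *ₚ A *ₚ invPoch b *ₚ C *ₚ invPoch (b + suc c)
    ≡⟨ cong (λ m → p *ₚ A *ₚ invPoch b *ₚ C *ₚ invPoch m) (ℕP.+-suc b c) ⟩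
  p *ₚ A *ₚ invPoch b *ₚ C *ₚ E
    ≈⟨ *ₚ-congʳ E (*ₚ-congʳ C (*ₚ-congˡ (p *ₚ A) (invPoch-suc b))) ⟨
  p *ₚ A *ₚ (1-q^ suc b *ₚ B) *ₚ C *ₚ E
    ≈⟨ solve 6 (λ p A o B C E → p :* A :* (o :* B) :* C :* E := o :* (p :* A :* B :* C :* E)) ≗-refl
               p A (1-q^ suc b) B C E ⟩
  1-q^ suc b *ₚ saalschützCommon a b c
    ∎
  where
  p = poch (suc (a + b + c))
  A = invPoch a
  B = invPoch (suc b)
  C = invPoch (suc (a + c))
  E = invPoch (suc (b + c))

saalschützProduct-sucᵃᵇ : ∀ a b c →
  1-q^ suc a *ₚ saalschützProduct (suc a) (suc b) c ≗ 1-q^ (suc (a + c) + suc b) *ₚ saalschützCommon a b c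
saalschützProduct-sucᵃᵇ a b c = begin
  1-q^ suc a *ₚ (poch (suc a + suc b + c) *ₚ invPoch (suc a) *ₚ B *ₚ C *ₚ E)
    ≡⟨ cong (λ m → 1-q^ suc a *ₚ (poch m *ₚ invPoch (suc a) *ₚ B *ₚ C *ₚ E)) (cong suc (middle a b c)) ⟩
  1-q^ suc a *ₚ (p *ₚ 1-q^ suc (suc (a + b + c)) *ₚ invPoch (suc a) *ₚ B *ₚ C *ₚ E)
    ≈⟨ solve 7 (λ u p o I B C E → u :* (p :* o :* I :* B :* C :* E) := o :* (p :* (u :* I) :* B :* C :* E)) ≗-refl
               (1-q^ suc a) p (1-q^ suc (suc (a + b + c))) (invPoch (suc a)) B C E ⟩
  1-q^ suc (suc (a + b + c)) *ₚ (p *ₚ (1-q^ suc a *ₚ invPoch (suc a)) *ₚ B *ₚ C *ₚ E)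
    ≈⟨ *ₚ-congˡ (1-q^ suc (suc (a + b + c))) (*ₚ-congʳ E (*ₚ-congʳ C (*ₚ-congʳ B (*ₚ-congˡ p (invPoch-suc a))))) ⟩
  1-q^ suc (suc (a + b + c)) *ₚ saalschützCommon a b c
    ≡⟨ cong (λ m → 1-q^ m *ₚ saalschützCommon a b c) (indices a b c) ⟩
  1-q^ (suc (a + c) + suc b) *ₚ saalschützCommon a b c
    ∎
  where
  p = poch (suc (a + b + c))
  B = invPoch (suc b)
  C = invPoch (suc (a + c))
  E = invPoch (suc (b + c))
  middle : ∀ a b c → a + suc b + c ≡ suc (a + b + c)
  middle = ℕ-Solver.solve-∀
  indices : ∀ a b c → suc (suc (a + b + c)) ≡ suc (a + c) + suc b
  indices = ℕ-Solver.solve-∀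

-- Up to the common factor, this is 1 − q^{m+n} = (1 − q^m) + q^m (1 − q^n) with m = a + c + 1, n = b + 1.
saalschützProduct-step : ∀ a b c →
  saalschützProduct a (suc b) c +ₚ qPow (suc (a + c)) *ₚ saalschützProduct a b (suc c)
    ≗ 1-q^ suc a *ₚ saalschützProduct (suc a) (suc b) c
saalschützProduct-step a b c = begin
  saalschützProduct a (suc b) c +ₚ x *ₚ saalschützProduct a b (suc c)
    ≈⟨ +ₚ-cong (saalschützProduct-sucᵇ a b c) (*ₚ-congˡ x (saalschützProduct-sucᶜ a b c)) ⟩
  1-q^ suc (a + c) *ₚ X +ₚ x *ₚ (1-q^ suc b *ₚ X)
    ≈⟨ solve 4 (λ o x o′ X → o :* X :+ x :* (o′ :* X) := (o :+ x :* o′) :* X) ≗-refl (1-q^ suc (a + c)) x (1-q^ suc b) X ⟩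
  (1-q^ suc (a + c) +ₚ x *ₚ 1-q^ suc b) *ₚ X
    ≈⟨ *ₚ-congʳ X (1-q^-+ (suc (a + c)) (suc b)) ⟨
  1-q^ (suc (a + c) + suc b) *ₚ X
    ≈⟨ saalschützProduct-sucᵃᵇ a b c ⟨
  1-q^ suc a *ₚ saalschützProduct (suc a) (suc b) c
    ∎
  where
  x = qPow (suc (a + c))
  X = saalschützCommon a b c

saalschütz-zeroᵇ : ∀ a c → ∑ (suc a) (saalschützTerm a c (invPochDiff 0)) ≗ saalschützProduct a 0 c
saalschütz-zeroᵇ a c = begin
  T 0 +ₚ ∑[ t < a ] T (suc t)
    ≈⟨ +ₚ-congˡ (T 0) (∑-zero a (λ t _ → solve 3 (λ x b i → x :* b :* con (+ 0) :* i := con (+ 0)) ≗-refl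
                                                  (qPow (suc t * suc t + suc t * c)) (qbin a (suc t)) (invPoch (c + suc t)))) ⟩
  1ₚ *ₚ (invPoch a *ₚ 1ₚ) *ₚ 1ₚ *ₚ invPoch (c + 0) +ₚ 0ₚ
    ≈⟨ solve 2 (λ A C → con (+ 1) :* (A :* con (+ 1)) :* con (+ 1) :* C :+ con (+ 0) := A :* C) ≗-refl (invPoch a) (invPoch (c + 0)) ⟩
  invPoch a *ₚ invPoch (c + 0)
    ≡⟨ cong (λ n → invPoch a *ₚ invPoch n) (ℕP.+-identityʳ c) ⟩
  invPoch a *ₚ invPoch c
    ≈⟨ *ₚ-identityˡ (invPoch a *ₚ invPoch c) ⟨
  1ₚ *ₚ (invPoch a *ₚ invPoch c)
    ≈⟨ *ₚ-congʳ (invPoch a *ₚ invPoch c) (poch*invPoch (a + c)) ⟨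
  (poch (a + c) *ₚ invPoch (a + c)) *ₚ (invPoch a *ₚ invPoch c)
    ≡⟨ cong (λ m → (poch (m + c) *ₚ invPoch (a + c)) *ₚ (invPoch a *ₚ invPoch c)) (ℕP.+-identityʳ a) ⟨
  (poch (a + 0 + c) *ₚ invPoch (a + c)) *ₚ (invPoch a *ₚ invPoch c)
    ≈⟨ solve 4 (λ p J A C → (p :* J) :* (A :* C) := p :* A :* con (+ 1) :* J :* C) ≗-refl
               (poch (a + 0 + c)) (invPoch (a + c)) (invPoch a) (invPoch c) ⟩
  saalschützProduct a 0 c
    ∎
  where
  T = saalschützTerm a c (invPochDiff 0)

saalschütz-zeroᵃ : ∀ b c → ∑ 1 (saalschützTerm 0 c (invPochDiff (suc b))) ≗ saalschützProduct 0 (suc b) c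
saalschütz-zeroᵃ b c = begin
  1ₚ *ₚ (1ₚ *ₚ 1ₚ) *ₚ invPoch (suc b) *ₚ invPoch (c + 0) +ₚ 0ₚ
    ≈⟨ solve 2 (λ B C → con (+ 1) :* (con (+ 1) :* con (+ 1)) :* B :* C :+ con (+ 0) := B :* C) ≗-refl
               (invPoch (suc b)) (invPoch (c + 0)) ⟩
  invPoch (suc b) *ₚ invPoch (c + 0)
    ≡⟨ cong (λ n → invPoch (suc b) *ₚ invPoch n) (ℕP.+-identityʳ c) ⟩
  invPoch (suc b) *ₚ invPoch c
    ≈⟨ *ₚ-identityˡ (invPoch (suc b) *ₚ invPoch c) ⟨
  1ₚ *ₚ (invPoch (suc b) *ₚ invPoch c)
    ≈⟨ *ₚ-congʳ (invPoch (suc b) *ₚ invPoch c) (poch*invPoch (suc (b + c))) ⟨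
  (poch (suc (b + c)) *ₚ invPoch (suc (b + c))) *ₚ (invPoch (suc b) *ₚ invPoch c)
    ≈⟨ solve 4 (λ p J B C → (p :* J) :* (B :* C) := p :* con (+ 1) :* B :* C :* J) ≗-refl
               (poch (suc (b + c))) (invPoch (suc (b + c))) (invPoch (suc b)) (invPoch c) ⟩
  saalschützProduct 0 (suc b) c
    ∎

saalschütz : ∀ a b c → ∑ (suc a) (saalschützTerm a c (invPochDiff b)) ≗ saalschützProduct a b c
saalschütz a       zero    c = saalschütz-zeroᵇ a c
saalschütz zero    (suc b) c = saalschütz-zeroᵃ b c
saalschütz (suc a) (suc b) c = 1-q^-cancelˡ a (begin
  1-q^ suc a *ₚ ∑ (suc (suc a)) (saalschützTerm (suc a) c (invPochDiff (suc b)))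
    ≈⟨ saalschütz-recurrence a c (invPochDiff (suc b)) ⟩
  ∑ (suc a) (saalschützTerm a c (invPochDiff (suc b)))
    +ₚ x *ₚ ∑ (suc a) (saalschützTerm a (suc c) (invPochDiff (suc b) ∘ suc))
    ≈⟨ +ₚ-congˡ (∑ (suc a) (saalschützTerm a c (invPochDiff (suc b))))
                (*ₚ-congˡ x (∑-saalschützTerm-cong (suc a) a (suc c) (invPochDiff-suc b))) ⟩
  ∑ (suc a) (saalschützTerm a c (invPochDiff (suc b))) +ₚ x *ₚ ∑ (suc a) (saalschützTerm a (suc c) (invPochDiff b))
    ≈⟨ +ₚ-cong (saalschütz a (suc b) c) (*ₚ-congˡ x (saalschütz a b (suc c))) ⟩
  saalschützProduct a (suc b) c +ₚ x *ₚ saalschützProduct a b (suc c)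
    ≈⟨ saalschützProduct-step a b c ⟩
  1-q^ suc a *ₚ saalschützProduct (suc a) (suc b) c
    ∎)
  where
  x = qPow (suc (a + c))

-- An alternating q-binomial sum and the unit Bailey pair

qbin-∑-pascal : ∀ m (f : ℕ → PS) →
  1-q^ suc m *ₚ ∑[ j < suc (suc m) ] (f j *ₚ qbin (suc m) j) ≗ ∑[ j < suc m ] ((qPow j *ₚ f j +ₚ f (suc j)) *ₚ qbin m j)
qbin-∑-pascal m f = begin
  1-q^ suc m *ₚ ∑[ j < suc (suc m) ] (f j *ₚ qbin (suc m) j)
    ≈⟨ *-distribˡ-∑ (suc (suc m)) (1-q^ suc m) (λ j → f j *ₚ qbin (suc m) j) ⟩
  ∑[ j < suc (suc m) ] (1-q^ suc m *ₚ (f j *ₚ qbin (suc m) j))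
    ≈⟨ ∑-cong-≗ (suc (suc m)) (λ j → solve 3 (λ o x b → o :* (x :* b) := x :* (o :* b)) ≗-refl (1-q^ suc m) (f j) (qbin (suc m) j)) ⟩
  f 0 *ₚ (1-q^ suc m *ₚ qbin (suc m) 0) +ₚ ∑[ s < suc m ] (f (suc s) *ₚ (1-q^ suc m *ₚ qbin (suc m) (suc s)))
    ≈⟨ +ₚ-cong (*ₚ-congˡ (f 0) (qbin-pascal₀ m)) (∑-cong-≗ (suc m) (λ s → *ₚ-congˡ (f (suc s)) (qbin-pascal′ m s))) ⟩
  f 0 *ₚ qbin m 0 +ₚ ∑[ s < suc m ] (f (suc s) *ₚ (qPow (suc s) *ₚ qbin m (suc s) +ₚ qbin m s))
    ≈⟨ +ₚ-cong (solve 2 (λ x b → x :* b := con (+ 1) :* x :* b) ≗-refl (f 0) (qbin m 0))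
               (∑-cong-≗ (suc m) (λ s → solve 4 (λ x y b c → x :* (y :* b :+ c) := y :* x :* b :+ x :* c) ≗-refl
                                                (f (suc s)) (qPow (suc s)) (qbin m (suc s)) (qbin m s))) ⟩
  qPow 0 *ₚ f 0 *ₚ qbin m 0 +ₚ ∑[ s < suc m ] (A (suc s) +ₚ B s)
    ≈⟨ +ₚ-congˡ (A 0) (∑-distrib-+ (suc m) (A ∘ suc) B) ⟩
  A 0 +ₚ (∑ (suc m) (A ∘ suc) +ₚ ∑ (suc m) B)
    ≈⟨ +-assoc (A 0) (∑ (suc m) (A ∘ suc)) (∑ (suc m) B) ⟨
  ∑ (suc (suc m)) A +ₚ ∑ (suc m) B
    ≈⟨ +ₚ-congʳ (∑ (suc m) B) (∑-truncate A (ℕP.n≤1+n (suc m)) beyond) ⟩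
  ∑ (suc m) A +ₚ ∑ (suc m) B
    ≈⟨ ∑-distrib-+ (suc m) A B ⟨
  ∑[ j < suc m ] (A j +ₚ B j)
    ≈⟨ ∑-cong-≗ (suc m) (λ j → ≗-sym (distribʳ (qbin m j) (qPow j *ₚ f j) (f (suc j)))) ⟩
  ∑[ j < suc m ] ((qPow j *ₚ f j +ₚ f (suc j)) *ₚ qbin m j)
    ∎
  where
  A B : ℕ → PS
  A j = qPow j *ₚ f j *ₚ qbin m j
  B j = f (suc j) *ₚ qbin m j
  beyond : ∀ j → suc m ≤ j → A j ≗ 0ₚ
  beyond j m<j = ≗-trans (*ₚ-congˡ (qPow j *ₚ f j) (qbin-> m<j)) (zeroʳ (qPow j *ₚ f j))

choose₂ : ℕ → ℕ
choose₂ zero    = 0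
choose₂ (suc n) = n + choose₂ n

-- shiftedChoose₂ u j = (j − u)(j − u − 1)/2, with j − u read as an integer.
shiftedChoose₂ : ℕ → ℕ → ℕ
shiftedChoose₂ zero    j       = choose₂ j
shiftedChoose₂ (suc u) zero    = choose₂ (suc (suc u))
shiftedChoose₂ (suc u) (suc j) = shiftedChoose₂ u j

shiftedChoose₂-zero : ∀ u → shiftedChoose₂ u 0 ≡ choose₂ (suc u)
shiftedChoose₂-zero zero    = refl
shiftedChoose₂-zero (suc u) = refl

shiftedChoose₂-suc : ∀ u j → shiftedChoose₂ u (suc j) + u ≡ shiftedChoose₂ u j + j
shiftedChoose₂-suc zero    j       = trans (ℕP.+-identityʳ (j + choose₂ j)) (ℕP.+-comm j (choose₂ j))
shiftedChoose₂-suc (suc u) zero    =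
  trans (cong (_+ suc u) (shiftedChoose₂-zero u))
        (trans (ℕP.+-comm (choose₂ (suc u)) (suc u)) (≡.sym (ℕP.+-identityʳ (choose₂ (suc (suc u))))))
shiftedChoose₂-suc (suc u) (suc j) =
  trans (ℕP.+-suc (shiftedChoose₂ u (suc j)) u)
        (trans (cong suc (shiftedChoose₂-suc u j)) (≡.sym (ℕP.+-suc (shiftedChoose₂ u j) j)))

shiftedChoose₂-+ : ∀ k u j → shiftedChoose₂ (k + u) (k + j) ≡ shiftedChoose₂ u j
shiftedChoose₂-+ zero    u j = refl
shiftedChoose₂-+ (suc k) u j = shiftedChoose₂-+ k u j

qPow*qPow-shiftedChoose₂ : ∀ u j → qPow u *ₚ qPow (shiftedChoose₂ u (suc j)) ≗ qPow (shiftedChoose₂ u j + j)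
qPow*qPow-shiftedChoose₂ u j = begin
  qPow u *ₚ qPow (shiftedChoose₂ u (suc j))   ≈⟨ *-comm (qPow u) (qPow (shiftedChoose₂ u (suc j))) ⟩
  qPow (shiftedChoose₂ u (suc j)) *ₚ qPow u   ≈⟨ qPow-+ (shiftedChoose₂ u (suc j)) u ⟩
  qPow (shiftedChoose₂ u (suc j) + u)         ≡⟨ cong qPow (shiftedChoose₂-suc u j) ⟩
  qPow (shiftedChoose₂ u j + j)               ∎

-- (q)_n · altBinomialSum n u = q^{u(u+1)/2} (q^{−u}; q)_n by the q-binomial theorem, so it
-- vanishes for u < n; below this is proved by a recurrence in n instead.
altBinomialTerm : ℕ → ℕ → ℕ → PS
altBinomialTerm n u j = sign j *ₚ qPow (shiftedChoose₂ u j) *ₚ qbin n j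

altBinomialSum : ℕ → ℕ → PS
altBinomialSum n u = ∑ (suc n) (altBinomialTerm n u)

altBinomialSum⁺ : ℕ → ℕ → PS
altBinomialSum⁺ n u = ∑[ j < suc n ] (sign j *ₚ qPow (shiftedChoose₂ u j + j) *ₚ qbin n j)

altBinomialSum-recurrence : ∀ m u →
  qPow u *ₚ (1-q^ suc m *ₚ altBinomialSum (suc m) u) ≗ -ₚ (1-q^ u *ₚ altBinomialSum⁺ m u)
altBinomialSum-recurrence m u = begin
  qPow u *ₚ (1-q^ suc m *ₚ altBinomialSum (suc m) u)
    ≈⟨ *ₚ-congˡ (qPow u) (qbin-∑-pascal m f) ⟩
  qPow u *ₚ ∑[ j < suc m ] ((qPow j *ₚ f j +ₚ f (suc j)) *ₚ qbin m j)
    ≈⟨ *-distribˡ-∑ (suc m) (qPow u) (λ j → (qPow j *ₚ f j +ₚ f (suc j)) *ₚ qbin m j) ⟩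
  ∑[ j < suc m ] (qPow u *ₚ ((qPow j *ₚ f j +ₚ f (suc j)) *ₚ qbin m j))
    ≈⟨ ∑-cong-≗ (suc m) term ⟩
  ∑[ j < suc m ] ((-ₚ (1-q^ u)) *ₚ (sign j *ₚ qPow (shiftedChoose₂ u j + j) *ₚ qbin m j))
    ≈⟨ *-distribˡ-∑ (suc m) (-ₚ (1-q^ u)) (λ j → sign j *ₚ qPow (shiftedChoose₂ u j + j) *ₚ qbin m j) ⟨
  (-ₚ (1-q^ u)) *ₚ altBinomialSum⁺ m u
    ≈⟨ -‿distribˡ-* (1-q^ u) (altBinomialSum⁺ m u) ⟨
  -ₚ (1-q^ u *ₚ altBinomialSum⁺ m u)
    ∎
  where
  f : ℕ → PS
  f j = sign j *ₚ qPow (shiftedChoose₂ u j)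
  term : ∀ j → qPow u *ₚ ((qPow j *ₚ f j +ₚ f (suc j)) *ₚ qbin m j)
               ≗ (-ₚ (1-q^ u)) *ₚ (sign j *ₚ qPow (shiftedChoose₂ u j + j) *ₚ qbin m j)
  term j = begin
    qPow u *ₚ ((qPow j *ₚ (s *ₚ Q) +ₚ (-ₚ s) *ₚ Q′) *ₚ b)
      ≈⟨ solve 6 (λ x y s Q Q′ b → x :* ((y :* (s :* Q) :+ (:- s) :* Q′) :* b) := x :* (s :* (Q :* y) :* b) :- s :* (x :* Q′) :* b)
                 ≗-refl (qPow u) (qPow j) s Q Q′ b ⟩
    qPow u *ₚ (s *ₚ (Q *ₚ qPow j) *ₚ b) +ₚ (-ₚ (s *ₚ (qPow u *ₚ Q′) *ₚ b))
      ≈⟨ +ₚ-cong (*ₚ-congˡ (qPow u) (*ₚ-congʳ b (*ₚ-congˡ s (qPow-+ (shiftedChoose₂ u j) j))))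
                 (-ₚ-cong (*ₚ-congʳ b (*ₚ-congˡ s (qPow*qPow-shiftedChoose₂ u j)))) ⟩
    qPow u *ₚ (s *ₚ P *ₚ b) +ₚ (-ₚ (s *ₚ P *ₚ b))
      ≈⟨ solve 2 (λ x y → x :* y :- y := (:- (con (+ 1) :- x)) :* y) ≗-refl (qPow u) (s *ₚ P *ₚ b) ⟩
    (-ₚ (1-q^ u)) *ₚ (s *ₚ P *ₚ b)
      ∎
    where
    s  = sign j
    Q  = qPow (shiftedChoose₂ u j)
    Q′ = qPow (shiftedChoose₂ u (suc j))
    P  = qPow (shiftedChoose₂ u j + j)
    b  = qbin m j

altBinomialSum⁺-suc : ∀ n u → altBinomialSum⁺ n (suc u) ≗ qPow (suc u) *ₚ altBinomialSum n u
altBinomialSum⁺-suc n u = begin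
  ∑[ j < suc n ] (sign j *ₚ qPow (shiftedChoose₂ (suc u) j + j) *ₚ qbin n j)
    ≈⟨ ∑-cong-≗ (suc n) term ⟩
  ∑[ j < suc n ] (qPow (suc u) *ₚ (sign j *ₚ qPow (shiftedChoose₂ u j) *ₚ qbin n j))
    ≈⟨ *-distribˡ-∑ (suc n) (qPow (suc u)) (λ j → sign j *ₚ qPow (shiftedChoose₂ u j) *ₚ qbin n j) ⟨
  qPow (suc u) *ₚ altBinomialSum n u
    ∎
  where
  term : ∀ j → sign j *ₚ qPow (shiftedChoose₂ (suc u) j + j) *ₚ qbin n j
               ≗ qPow (suc u) *ₚ (sign j *ₚ qPow (shiftedChoose₂ u j) *ₚ qbin n j)
  term j = begin
    sign j *ₚ qPow (shiftedChoose₂ (suc u) j + j) *ₚ qbin n j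
      ≡⟨ cong (λ e → sign j *ₚ qPow e *ₚ qbin n j) (≡.sym (shiftedChoose₂-suc (suc u) j)) ⟩
    sign j *ₚ qPow (shiftedChoose₂ u j + suc u) *ₚ qbin n j
      ≈⟨ *ₚ-congʳ (qbin n j) (*ₚ-congˡ (sign j) (qPow-+ (shiftedChoose₂ u j) (suc u))) ⟨
    sign j *ₚ (qPow (shiftedChoose₂ u j) *ₚ qPow (suc u)) *ₚ qbin n j
      ≈⟨ solve 4 (λ s Q x b → s :* (Q :* x) :* b := x :* (s :* Q :* b)) ≗-refl
                 (sign j) (qPow (shiftedChoose₂ u j)) (qPow (suc u)) (qbin n j) ⟩
    qPow (suc u) *ₚ (sign j *ₚ qPow (shiftedChoose₂ u j) *ₚ qbin n j)
      ∎

altBinomialSum-vanishes : ∀ m u → u ≤ m → altBinomialSum (suc m) u ≗ 0ₚ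
altBinomialSum-vanishes m zero _ = 1-q^-cancelˡ m (begin
  1-q^ suc m *ₚ H                   ≈⟨ *ₚ-identityˡ (1-q^ suc m *ₚ H) ⟨
  qPow 0 *ₚ (1-q^ suc m *ₚ H)       ≈⟨ altBinomialSum-recurrence m 0 ⟩
  -ₚ (1-q^ 0 *ₚ altBinomialSum⁺ m 0) ≈⟨ solve 2 (λ C o → :- ((con (+ 1) :- con (+ 1)) :* C) := o :* con (+ 0)) ≗-refl
                                              (altBinomialSum⁺ m 0) (1-q^ suc m) ⟩
  1-q^ suc m *ₚ 0ₚ                  ∎)
  where
  H = altBinomialSum (suc m) 0
altBinomialSum-vanishes (suc m) (suc u) (s≤s u≤m) = 1-q^-cancelˡ (suc m) (qPow-*ₚ-cancelˡ (suc u) (begin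
  qPow (suc u) *ₚ (1-q^ suc (suc m) *ₚ altBinomialSum (suc (suc m)) (suc u))
    ≈⟨ altBinomialSum-recurrence (suc m) (suc u) ⟩
  -ₚ (1-q^ suc u *ₚ altBinomialSum⁺ (suc m) (suc u))
    ≈⟨ -ₚ-cong (*ₚ-congˡ (1-q^ suc u) (altBinomialSum⁺-suc (suc m) u)) ⟩
  -ₚ (1-q^ suc u *ₚ (qPow (suc u) *ₚ altBinomialSum (suc m) u))
    ≈⟨ -ₚ-cong (*ₚ-congˡ (1-q^ suc u) (*ₚ-congˡ (qPow (suc u)) (altBinomialSum-vanishes m u u≤m))) ⟩
  -ₚ (1-q^ suc u *ₚ (qPow (suc u) *ₚ 0ₚ))
    ≈⟨ solve 3 (λ o x p → :- (o :* (x :* con (+ 0))) := x :* (p :* con (+ 0))) ≗-refl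
               (1-q^ suc u) (qPow (suc u)) (1-q^ suc (suc m)) ⟩
  qPow (suc u) *ₚ (1-q^ suc (suc m) *ₚ 0ₚ)
    ∎))

unitα : ℕ → PS
unitα zero    = 1ₚ
unitα (suc r) = sign (suc r) *ₚ qPow (choose₂ (suc r)) *ₚ (1ₚ +ₚ qPow (suc r))

unitα-suc : ∀ i → unitα (suc i) ≗ sign (suc i) *ₚ qPow (choose₂ (suc i)) +ₚ sign (suc i) *ₚ qPow (choose₂ (suc i) + suc i)
unitα-suc i = begin
  s *ₚ qPow c *ₚ (1ₚ +ₚ qPow (suc i))
    ≈⟨ solve 3 (λ s Q x → s :* Q :* (con (+ 1) :+ x) := s :* Q :+ s :* (Q :* x)) ≗-refl s (qPow c) (qPow (suc i)) ⟩
  s *ₚ qPow c +ₚ s *ₚ (qPow c *ₚ qPow (suc i))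
    ≈⟨ +ₚ-congˡ (s *ₚ qPow c) (*ₚ-congˡ s (qPow-+ c (suc i))) ⟩
  s *ₚ qPow c +ₚ s *ₚ qPow (c + suc i)
    ∎
  where
  s = sign (suc i)
  c = choose₂ (suc i)

pairKernel : ℕ → ℕ → PS
pairKernel L r = invPochDiff L r *ₚ invPoch (L + r)

pairβ : (ℕ → PS) → ℕ → PS
pairβ α L = ∑[ r < suc L ] (α r *ₚ pairKernel L r)

unitβ : ℕ → PS
unitβ zero    = 1ₚ
unitβ (suc _) = 0ₚ

altBinomialTerm-upper : ∀ L r →
  altBinomialTerm (L + L) L (L + r) ≗ sign L *ₚ (sign r *ₚ qPow (choose₂ r) *ₚ pairKernel L r)
altBinomialTerm-upper L r = begin
  sign (L + r) *ₚ qPow (shiftedChoose₂ L (L + r)) *ₚ qbin (L + L) (L + r)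
    ≈⟨ *ₚ-cong (*ₚ-cong (sign-+ L r) (cong-app (cong qPow exponent)))
               (*ₚ-congʳ (invPoch (L + r)) (cong-app (invPochDiff-+ L L r))) ⟩
  sign L *ₚ sign r *ₚ qPow (choose₂ r) *ₚ pairKernel L r
    ≈⟨ solve 4 (λ a b c d → a :* b :* c :* d := a :* (b :* c :* d)) ≗-refl
               (sign L) (sign r) (qPow (choose₂ r)) (pairKernel L r) ⟩
  sign L *ₚ (sign r *ₚ qPow (choose₂ r) *ₚ pairKernel L r)
    ∎
  where
  exponent : shiftedChoose₂ L (L + r) ≡ choose₂ r
  exponent = trans (cong (λ u → shiftedChoose₂ u (L + r)) (≡.sym (ℕP.+-identityʳ L))) (shiftedChoose₂-+ L 0 r)

altBinomialTerm-lower : ∀ L i → i < L →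
  altBinomialTerm (L + L) L (L ∸ suc i)
    ≗ sign L *ₚ (sign (suc i) *ₚ qPow (choose₂ (suc i) + suc i) *ₚ pairKernel L (suc i))
altBinomialTerm-lower L i i<L with L ∸ suc i | ℕP.m+[n∸m]≡n i<L
... | d | refl = begin
  sign d *ₚ qPow (shiftedChoose₂ L d) *ₚ qbin (L + L) d
    ≈⟨ *ₚ-cong (*ₚ-cong (≗-sym signs) (cong-app (cong qPow exponent))) (qbin-split d (L + suc i) indices) ⟩
  sign L *ₚ sign (suc i) *ₚ qPow (choose₂ (suc i) + suc i) *ₚ (invPoch (L + suc i) *ₚ invPoch d)
    ≈⟨ solve 5 (λ a b c x y → a :* b :* c :* (x :* y) := a :* (b :* c :* (y :* x))) ≗-refl
               (sign L) (sign (suc i)) (qPow (choose₂ (suc i) + suc i)) (invPoch (L + suc i)) (invPoch d) ⟩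
  sign L *ₚ (sign (suc i) *ₚ qPow (choose₂ (suc i) + suc i) *ₚ (invPoch d *ₚ invPoch (L + suc i)))
    ≈⟨ *ₚ-congˡ (sign L) (*ₚ-congˡ (sign (suc i) *ₚ qPow (choose₂ (suc i) + suc i)) (*ₚ-congʳ (invPoch (L + suc i)) kernel)) ⟩
  sign L *ₚ (sign (suc i) *ₚ qPow (choose₂ (suc i) + suc i) *ₚ pairKernel L (suc i))
    ∎
  where
  signs : sign L *ₚ sign (suc i) ≗ sign d
  signs = begin
    sign L *ₚ sign (suc i)                         ≈⟨ *ₚ-congʳ (sign (suc i)) (sign-+ (suc i) d) ⟩
    sign (suc i) *ₚ sign d *ₚ sign (suc i)          ≈⟨ solve 2 (λ a b → a :* b :* a := (a :* a) :* b) ≗-refl (sign (suc i)) (sign d) ⟩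
    (sign (suc i) *ₚ sign (suc i)) *ₚ sign d        ≈⟨ *ₚ-congʳ (sign d) (sign*sign (suc i)) ⟩
    1ₚ *ₚ sign d                                  ≈⟨ *ₚ-identityˡ (sign d) ⟩
    sign d                                        ∎
  exponent : shiftedChoose₂ L d ≡ choose₂ (suc i) + suc i
  exponent = trans (cong₂ shiftedChoose₂ (ℕP.+-comm (suc i) d) (≡.sym (ℕP.+-identityʳ d)))
                   (trans (shiftedChoose₂-+ d (suc i) 0) (ℕP.+-comm (suc i) (choose₂ (suc i))))
  indices : L + L ≡ d + (L + suc i)
  indices = rearrange i d
    where
    rearrange : ∀ i d → suc i + d + (suc i + d) ≡ d + (suc i + d + suc i)
    rearrange = ℕ-Solver.solve-∀
  kernel : invPoch d ≗ invPochDiff L (suc i)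
  kernel = cong-app (≡.sym (trans (invPochDiff-≤ {L} (s≤s (ℕP.m≤m+n i d))) (cong invPoch (ℕP.m+n∸m≡n i d))))

-- The terms j = L + r and j = L − r of altBinomialSum (L + L) L combine into unitα r · pairKernel L r.
sign*pairβ-unitα : ∀ L → sign L *ₚ pairβ unitα L ≗ altBinomialSum (L + L) L
sign*pairβ-unitα L = begin
  sign L *ₚ pairβ unitα L
    ≈⟨ *-distribˡ-∑ (suc L) (sign L) (λ r → unitα r *ₚ pairKernel L r) ⟩
  sign L *ₚ (1ₚ *ₚ pairKernel L 0) +ₚ ∑[ i < L ] (sign L *ₚ (unitα (suc i) *ₚ pairKernel L (suc i)))
    ≈⟨ +ₚ-cong (solve 2 (λ s K → s :* (con (+ 1) :* K) := s :* (con (+ 1) :* con (+ 1) :* K)) ≗-refl (sign L) (pairKernel L 0))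
               (∑-cong-≗ L split) ⟩
  up 0 +ₚ ∑[ i < L ] (up (suc i) +ₚ low i)
    ≈⟨ +ₚ-congˡ (up 0) (∑-distrib-+ L (up ∘ suc) low) ⟩
  up 0 +ₚ (∑ L (up ∘ suc) +ₚ ∑ L low)
    ≈⟨ +-assoc (up 0) (∑ L (up ∘ suc)) (∑ L low) ⟨
  ∑ (suc L) up +ₚ ∑ L low
    ≈⟨ +ₚ-cong (∑-cong-≗ (suc L) (λ r → ≗-sym (altBinomialTerm-upper L r)))
               (∑-cong L (λ i i<L → ≗-sym (altBinomialTerm-lower L i i<L))) ⟩
  ∑[ r < suc L ] h (L + r) +ₚ ∑[ i < L ] h (L ∸ suc i)
    ≈⟨ +ₚ-congˡ (∑[ r < suc L ] h (L + r)) (∑-reverse L h) ⟨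
  ∑[ r < suc L ] h (L + r) +ₚ ∑ L h
    ≈⟨ +-comm (∑[ r < suc L ] h (L + r)) (∑ L h) ⟩
  ∑ L h +ₚ ∑[ r < suc L ] h (L + r)
    ≈⟨ ∑-split L (suc L) h ⟨
  ∑ (L + suc L) h
    ≡⟨ cong (λ n → ∑ n h) (ℕP.+-suc L L) ⟩
  altBinomialSum (L + L) L
    ∎
  where
  h = altBinomialTerm (L + L) L
  up : ℕ → PS
  up r = sign L *ₚ (sign r *ₚ qPow (choose₂ r) *ₚ pairKernel L r)
  low : ℕ → PS
  low i = sign L *ₚ (sign (suc i) *ₚ qPow (choose₂ (suc i) + suc i) *ₚ pairKernel L (suc i))
  split : ∀ i → sign L *ₚ (unitα (suc i) *ₚ pairKernel L (suc i)) ≗ up (suc i) +ₚ low i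
  split i = ≗-trans (*ₚ-congˡ (sign L) (*ₚ-congʳ (pairKernel L (suc i)) (unitα-suc i)))
                    (solve 5 (λ σ s Q Q′ K → σ :* ((s :* Q :+ s :* Q′) :* K) := σ :* (s :* Q :* K) :+ σ :* (s :* Q′ :* K)) ≗-refl
                           (sign L) (sign (suc i)) (qPow (choose₂ (suc i))) (qPow (choose₂ (suc i) + suc i)) (pairKernel L (suc i)))

unit-bailey-pair : ∀ L → pairβ unitα L ≗ unitβ L
unit-bailey-pair zero    = solve 0 (con (+ 1) :* (con (+ 1) :* con (+ 1)) :+ con (+ 0) := con (+ 1)) ≗-refl
unit-bailey-pair (suc L) = begin
  pairβ unitα (suc L)
    ≈⟨ *ₚ-identityˡ (pairβ unitα (suc L)) ⟨
  1ₚ *ₚ pairβ unitα (suc L)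
    ≈⟨ *ₚ-congʳ (pairβ unitα (suc L)) (sign*sign (suc L)) ⟨
  sign (suc L) *ₚ sign (suc L) *ₚ pairβ unitα (suc L)
    ≈⟨ *-assoc (sign (suc L)) (sign (suc L)) (pairβ unitα (suc L)) ⟩
  sign (suc L) *ₚ (sign (suc L) *ₚ pairβ unitα (suc L))
    ≈⟨ *ₚ-congˡ (sign (suc L)) (sign*pairβ-unitα (suc L)) ⟩
  sign (suc L) *ₚ altBinomialSum (suc L + suc L) (suc L)
    ≈⟨ *ₚ-congˡ (sign (suc L)) (altBinomialSum-vanishes (L + suc L) (suc L) (ℕP.m≤n+m (suc L) L)) ⟩
  sign (suc L) *ₚ 0ₚ
    ≈⟨ zeroʳ (sign (suc L)) ⟩
  0ₚ
    ∎

-- The Bailey lemma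

pairKernel-> : ∀ {j r} → j < r → pairKernel j r ≗ 0ₚ
pairKernel-> {j} {r} j<r = ≗-trans (*ₚ-congʳ (invPoch (j + r)) (cong-app (invPochDiff-> j<r))) (zeroˡ (invPoch (j + r)))

pairKernel-≤ : ∀ {L r} → r ≤ L → pairKernel L r ≗ invPoch (L ∸ r) *ₚ invPoch (L + r)
pairKernel-≤ {L} {r} r≤L = *ₚ-congʳ (invPoch (L + r)) (cong-app (invPochDiff-≤ r≤L))

pairβ-extend : ∀ α {j L} → j ≤ L → pairβ α j ≗ ∑[ r < suc L ] (α r *ₚ pairKernel j r)
pairβ-extend α {j} {L} j≤L = ≗-sym (∑-truncate (λ r → α r *ₚ pairKernel j r) (s≤s j≤L)
  (λ r j<r → ≗-trans (*ₚ-congˡ (α r) (pairKernel-> j<r)) (zeroʳ (α r))))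

∑-pairβ : ∀ L (c α : ℕ → PS) →
  ∑[ j < suc L ] (c j *ₚ pairβ α j) ≗ ∑[ r < suc L ] (α r *ₚ ∑[ j < suc L ] (c j *ₚ pairKernel j r))
∑-pairβ L c α = begin
  ∑[ j < suc L ] (c j *ₚ pairβ α j)
    ≈⟨ ∑-cong (suc L) (λ j j≤L → *ₚ-congˡ (c j) (pairβ-extend α (ℕP.≤-pred j≤L))) ⟩
  ∑[ j < suc L ] (c j *ₚ ∑[ r < suc L ] (α r *ₚ pairKernel j r))
    ≈⟨ ∑-cong-≗ (suc L) (λ j → *-distribˡ-∑ (suc L) (c j) (λ r → α r *ₚ pairKernel j r)) ⟩
  ∑[ j < suc L ] ∑[ r < suc L ] (c j *ₚ (α r *ₚ pairKernel j r))
    ≈⟨ ∑-swap (suc L) (suc L) (λ j r → c j *ₚ (α r *ₚ pairKernel j r)) ⟩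
  ∑[ r < suc L ] ∑[ j < suc L ] (c j *ₚ (α r *ₚ pairKernel j r))
    ≈⟨ ∑-cong-≗ (suc L) (λ r → ∑-cong-≗ (suc L) (λ j → solve 3 (λ c a K → c :* (a :* K) := a :* (c :* K)) ≗-refl
                                                                 (c j) (α r) (pairKernel j r))) ⟩
  ∑[ r < suc L ] ∑[ j < suc L ] (α r *ₚ (c j *ₚ pairKernel j r))
    ≈⟨ ∑-cong-≗ (suc L) (λ r → *-distribˡ-∑ (suc L) (α r) (λ j → c j *ₚ pairKernel j r)) ⟨
  ∑[ r < suc L ] (α r *ₚ ∑[ j < suc L ] (c j *ₚ pairKernel j r))
    ∎

-- Writing j = r + s turns the sum over j into a q-Pfaff–Saalschütz sum over s.
∑-pairKernel : ∀ L r (w : ℕ → PS) → r ≤ L →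
  ∑[ j < suc L ] (qPow (j * j) *ₚ invPochDiff L j *ₚ w j *ₚ pairKernel j r)
    ≗ qPow (r * r) *ₚ ∑ (suc (L ∸ r)) (saalschützTerm (L ∸ r) (r + r) (λ s → w (r + s)))
∑-pairKernel L r w r≤L = begin
  ∑[ j < suc L ] f j
    ≈⟨ ∑-drop f (ℕP.m≤n⇒m≤1+n r≤L) (λ j j<r → ≗-trans (*ₚ-congˡ (qPow (j * j) *ₚ invPochDiff L j *ₚ w j) (pairKernel-> j<r))
                                                        (zeroʳ (qPow (j * j) *ₚ invPochDiff L j *ₚ w j))) ⟩
  ∑[ s < suc L ∸ r ] f (r + s)
    ≡⟨ cong (λ n → ∑[ s < n ] f (r + s)) (ℕP.+-∸-assoc 1 r≤L) ⟩
  ∑[ s < suc (L ∸ r) ] f (r + s)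
    ≈⟨ ∑-cong-≗ (suc (L ∸ r)) term ⟩
  ∑[ s < suc (L ∸ r) ] (qPow (r * r) *ₚ saalschützTerm (L ∸ r) (r + r) (λ s → w (r + s)) s)
    ≈⟨ *-distribˡ-∑ (suc (L ∸ r)) (qPow (r * r)) (saalschützTerm (L ∸ r) (r + r) (λ s → w (r + s))) ⟨
  qPow (r * r) *ₚ ∑ (suc (L ∸ r)) (saalschützTerm (L ∸ r) (r + r) (λ s → w (r + s)))
    ∎
  where
  f : ℕ → PS
  f j = qPow (j * j) *ₚ invPochDiff L j *ₚ w j *ₚ pairKernel j r
  square : ∀ r s → (r + s) * (r + s) ≡ r * r + (s * s + s * (r + r))
  square = ℕ-Solver.solve-∀
  indices : ∀ r s → r + s + r ≡ r + r + s
  indices = ℕ-Solver.solve-∀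
  term : ∀ s → f (r + s) ≗ qPow (r * r) *ₚ saalschützTerm (L ∸ r) (r + r) (λ s → w (r + s)) s
  term s = begin
    qPow ((r + s) * (r + s)) *ₚ invPochDiff L (r + s) *ₚ w (r + s) *ₚ (invPochDiff (r + s) r *ₚ invPoch (r + s + r))
      ≈⟨ *ₚ-cong (*ₚ-congʳ (w (r + s)) (*ₚ-cong (≗-trans (cong-app (cong qPow (square r s))) (≗-sym (qPow-+ (r * r) (s * s + s * (r + r)))))
                                                 (cong-app (invPochDiff-shift s r≤L))))
                 (*ₚ-cong (cong-app D-diag) (cong-app (cong invPoch (indices r s)))) ⟩
    qPow (r * r) *ₚ qPow (s * s + s * (r + r)) *ₚ invPochDiff (L ∸ r) s *ₚ w (r + s) *ₚ (invPoch s *ₚ invPoch (r + r + s))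
      ≈⟨ solve 6 (λ x y D v I J → x :* y :* D :* v :* (I :* J) := x :* (y :* (D :* I) :* v :* J)) ≗-refl
                 (qPow (r * r)) (qPow (s * s + s * (r + r))) (invPochDiff (L ∸ r) s) (w (r + s)) (invPoch s) (invPoch (r + r + s)) ⟩
    qPow (r * r) *ₚ saalschützTerm (L ∸ r) (r + r) (λ s → w (r + s)) s
      ∎
    where
    D-diag : invPochDiff (r + s) r ≡ invPoch s
    D-diag = trans (invPochDiff-≤ (ℕP.m≤m+n r s)) (cong invPoch (ℕP.m+n∸m≡n r s))

m∸n+[n+n]≡m+n : ∀ {m n} → n ≤ m → m ∸ n + (n + n) ≡ m + n
m∸n+[n+n]≡m+n {m} {n} n≤m = trans (≡.sym (ℕP.+-assoc (m ∸ n) n n)) (cong (_+ n) (ℕP.m∸n+n≡m n≤m))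

∑-pairKernel-saalschütz∞ : ∀ L r → r ≤ L →
  ∑[ j < suc L ] (qPow (j * j) *ₚ invPochDiff L j *ₚ pairKernel j r) ≗ qPow (r * r) *ₚ pairKernel L r
∑-pairKernel-saalschütz∞ L r r≤L = begin
  ∑[ j < suc L ] (qPow (j * j) *ₚ invPochDiff L j *ₚ pairKernel j r)
    ≈⟨ ∑-cong-≗ (suc L) (λ j → ≗-sym (*ₚ-congʳ (pairKernel j r) (*-identityʳ (qPow (j * j) *ₚ invPochDiff L j)))) ⟩
  ∑[ j < suc L ] (qPow (j * j) *ₚ invPochDiff L j *ₚ 1ₚ *ₚ pairKernel j r)
    ≈⟨ ∑-pairKernel L r (λ _ → 1ₚ) r≤L ⟩
  qPow (r * r) *ₚ ∑ (suc (L ∸ r)) (saalschützTerm (L ∸ r) (r + r) (λ _ → 1ₚ))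
    ≈⟨ *ₚ-congˡ (qPow (r * r)) (saalschütz∞ (L ∸ r) (r + r)) ⟩
  qPow (r * r) *ₚ (invPoch (L ∸ r) *ₚ invPoch (L ∸ r + (r + r)))
    ≡⟨ cong (λ n → qPow (r * r) *ₚ (invPoch (L ∸ r) *ₚ invPoch n)) (m∸n+[n+n]≡m+n r≤L) ⟩
  qPow (r * r) *ₚ (invPoch (L ∸ r) *ₚ invPoch (L + r))
    ≈⟨ *ₚ-congˡ (qPow (r * r)) (pairKernel-≤ r≤L) ⟨
  qPow (r * r) *ₚ pairKernel L r
    ∎

saalschützProduct-shift : ∀ {L M r} → r ≤ L → r ≤ M →
  saalschützProduct (L ∸ r) (M ∸ r) (r + r) ≗ poch (L + M) *ₚ pairKernel M r *ₚ pairKernel L r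
saalschützProduct-shift {L} {M} {r} r≤L r≤M = begin
  poch (L ∸ r + (M ∸ r) + (r + r)) *ₚ invPoch (L ∸ r) *ₚ invPoch (M ∸ r) *ₚ invPoch (L ∸ r + (r + r)) *ₚ invPoch (M ∸ r + (r + r))
    ≡⟨ cong₂ (λ m n → poch m *ₚ invPoch (L ∸ r) *ₚ invPoch (M ∸ r) *ₚ invPoch (L ∸ r + (r + r)) *ₚ invPoch n)
             total (m∸n+[n+n]≡m+n r≤M) ⟩
  poch (L + M) *ₚ invPoch (L ∸ r) *ₚ invPoch (M ∸ r) *ₚ invPoch (L ∸ r + (r + r)) *ₚ invPoch (M + r)
    ≡⟨ cong (λ n → poch (L + M) *ₚ invPoch (L ∸ r) *ₚ invPoch (M ∸ r) *ₚ invPoch n *ₚ invPoch (M + r)) (m∸n+[n+n]≡m+n r≤L) ⟩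
  poch (L + M) *ₚ invPoch (L ∸ r) *ₚ invPoch (M ∸ r) *ₚ invPoch (L + r) *ₚ invPoch (M + r)
    ≈⟨ solve 5 (λ p A B C E → p :* A :* B :* C :* E := p :* (B :* E) :* (A :* C)) ≗-refl
               (poch (L + M)) (invPoch (L ∸ r)) (invPoch (M ∸ r)) (invPoch (L + r)) (invPoch (M + r)) ⟩
  poch (L + M) *ₚ (invPoch (M ∸ r) *ₚ invPoch (M + r)) *ₚ (invPoch (L ∸ r) *ₚ invPoch (L + r))
    ≈⟨ *ₚ-cong (*ₚ-congˡ (poch (L + M)) (pairKernel-≤ r≤M)) (pairKernel-≤ r≤L) ⟨
  poch (L + M) *ₚ pairKernel M r *ₚ pairKernel L r
    ∎
  where
  regroup : ∀ a b r → a + b + (r + r) ≡ (a + r) + (b + r)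
  regroup = ℕ-Solver.solve-∀
  total : L ∸ r + (M ∸ r) + (r + r) ≡ L + M
  total = trans (regroup (L ∸ r) (M ∸ r) r) (cong₂ _+_ (ℕP.m∸n+n≡m r≤L) (ℕP.m∸n+n≡m r≤M))

∑-pairKernel-saalschütz : ∀ L M r → r ≤ L →
  ∑[ j < suc L ] (qPow (j * j) *ₚ invPochDiff L j *ₚ invPochDiff M j *ₚ pairKernel j r)
    ≗ qPow (r * r) *ₚ poch (L + M) *ₚ pairKernel M r *ₚ pairKernel L r
∑-pairKernel-saalschütz L M r r≤L with M ℕ.<? r
... | no M≮r = begin
  ∑[ j < suc L ] (qPow (j * j) *ₚ invPochDiff L j *ₚ invPochDiff M j *ₚ pairKernel j r)
    ≈⟨ ∑-pairKernel L r (invPochDiff M) r≤L ⟩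
  qPow (r * r) *ₚ ∑ (suc (L ∸ r)) (saalschützTerm (L ∸ r) (r + r) (λ s → invPochDiff M (r + s)))
    ≈⟨ *ₚ-congˡ (qPow (r * r)) (∑-saalschützTerm-cong (suc (L ∸ r)) (L ∸ r) (r + r) (λ s → invPochDiff-shift s r≤M)) ⟩
  qPow (r * r) *ₚ ∑ (suc (L ∸ r)) (saalschützTerm (L ∸ r) (r + r) (invPochDiff (M ∸ r)))
    ≈⟨ *ₚ-congˡ (qPow (r * r)) (≗-trans (saalschütz (L ∸ r) (M ∸ r) (r + r)) (saalschützProduct-shift r≤L r≤M)) ⟩
  qPow (r * r) *ₚ (poch (L + M) *ₚ pairKernel M r *ₚ pairKernel L r)
    ≈⟨ solve 4 (λ x p K K′ → x :* (p :* K :* K′) := x :* p :* K :* K′) ≗-refl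
               (qPow (r * r)) (poch (L + M)) (pairKernel M r) (pairKernel L r) ⟩
  qPow (r * r) *ₚ poch (L + M) *ₚ pairKernel M r *ₚ pairKernel L r
    ∎
  where
  r≤M = ℕP.≮⇒≥ M≮r
... | yes M<r = begin
  ∑[ j < suc L ] (qPow (j * j) *ₚ invPochDiff L j *ₚ invPochDiff M j *ₚ pairKernel j r)
    ≈⟨ ∑-zero (suc L) vanish ⟩
  0ₚ
    ≈⟨ solve 2 (λ x K → con (+ 0) := x :* con (+ 0) :* K) ≗-refl (qPow (r * r) *ₚ poch (L + M)) (pairKernel L r) ⟩
  qPow (r * r) *ₚ poch (L + M) *ₚ 0ₚ *ₚ pairKernel L r
    ≈⟨ *ₚ-congʳ (pairKernel L r) (*ₚ-congˡ (qPow (r * r) *ₚ poch (L + M)) (pairKernel-> M<r)) ⟨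
  qPow (r * r) *ₚ poch (L + M) *ₚ pairKernel M r *ₚ pairKernel L r
    ∎
  where
  vanish : ∀ j → j < suc L → qPow (j * j) *ₚ invPochDiff L j *ₚ invPochDiff M j *ₚ pairKernel j r ≗ 0ₚ
  vanish j _ with j ℕ.<? r
  ... | yes j<r = ≗-trans (*ₚ-congˡ (qPow (j * j) *ₚ invPochDiff L j *ₚ invPochDiff M j) (pairKernel-> j<r))
                          (zeroʳ (qPow (j * j) *ₚ invPochDiff L j *ₚ invPochDiff M j))
  ... | no j≮r  = ≗-trans (*ₚ-congʳ (pairKernel j r) (*ₚ-congˡ (qPow (j * j) *ₚ invPochDiff L j)
                                     (cong-app (invPochDiff-> (ℕP.<-≤-trans M<r (ℕP.≮⇒≥ j≮r))))))
                          (solve 3 (λ x D K → x :* D :* con (+ 0) :* K := con (+ 0)) ≗-refl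
                                 (qPow (j * j)) (invPochDiff L j) (pairKernel j r))

-- The β-side of the Bailey lemma (a = 1, ρ₁, ρ₂ → ∞): β′_L = Σ_{j ≤ L} q^{j²} β_j / (q)_{L−j}.
stepβ : (ℕ → PS) → ℕ → PS
stepβ β L = ∑[ j < suc L ] (qPow (j * j) *ₚ invPochDiff L j *ₚ β j)

bailey-lemma : ∀ α L → stepβ (pairβ α) L ≗ pairβ (λ r → qPow (r * r) *ₚ α r) L
bailey-lemma α L = begin
  ∑[ j < suc L ] (qPow (j * j) *ₚ invPochDiff L j *ₚ pairβ α j)
    ≈⟨ ∑-pairβ L (λ j → qPow (j * j) *ₚ invPochDiff L j) α ⟩
  ∑[ r < suc L ] (α r *ₚ ∑[ j < suc L ] (qPow (j * j) *ₚ invPochDiff L j *ₚ pairKernel j r))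
    ≈⟨ ∑-cong (suc L) (λ r r≤L → *ₚ-congˡ (α r) (∑-pairKernel-saalschütz∞ L r (ℕP.≤-pred r≤L))) ⟩
  ∑[ r < suc L ] (α r *ₚ (qPow (r * r) *ₚ pairKernel L r))
    ≈⟨ ∑-cong-≗ (suc L) (λ r → solve 3 (λ a x K → a :* (x :* K) := x :* a :* K) ≗-refl (α r) (qPow (r * r)) (pairKernel L r)) ⟩
  pairβ (λ r → qPow (r * r) *ₚ α r) L
    ∎

unitα-kernel-sum : ∀ L M →
  ∑[ r < suc L ] (unitα r *ₚ (qPow (r * r) *ₚ poch (L + M) *ₚ pairKernel M r *ₚ pairKernel L r)) ≗ invPoch L *ₚ invPoch M
unitα-kernel-sum L M = begin
  ∑[ r < suc L ] (unitα r *ₚ (qPow (r * r) *ₚ poch (L + M) *ₚ pairKernel M r *ₚ pairKernel L r))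
    ≈⟨ ∑-cong (suc L) (λ r r≤L → *ₚ-congˡ (unitα r) (∑-pairKernel-saalschütz L M r (ℕP.≤-pred r≤L))) ⟨
  ∑[ r < suc L ] (unitα r *ₚ ∑[ j < suc L ] (c j *ₚ pairKernel j r))
    ≈⟨ ∑-pairβ L c unitα ⟨
  ∑[ j < suc L ] (c j *ₚ pairβ unitα j)
    ≈⟨ ∑-cong-≗ (suc L) (λ j → *ₚ-congˡ (c j) (unit-bailey-pair j)) ⟩
  c 0 *ₚ 1ₚ +ₚ ∑[ i < L ] (c (suc i) *ₚ 0ₚ)
    ≈⟨ +ₚ-cong (*-identityʳ (c 0)) (∑-zero L (λ i _ → zeroʳ (c (suc i)))) ⟩
  1ₚ *ₚ invPoch L *ₚ invPoch M +ₚ 0ₚ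
    ≈⟨ solve 2 (λ A B → con (+ 1) :* A :* B :+ con (+ 0) := A :* B) ≗-refl (invPoch L) (invPoch M) ⟩
  invPoch L *ₚ invPoch M
    ∎
  where
  c : ℕ → PS
  c j = qPow (j * j) *ₚ invPochDiff L j *ₚ invPochDiff M j

stepβ-cong : ∀ {x y} → (∀ L → x L ≗ y L) → ∀ L → stepβ x L ≗ stepβ y L
stepβ-cong {x} {y} x≗y L = ∑-cong-≗ (suc L) (λ j → *ₚ-congˡ (qPow (j * j) *ₚ invPochDiff L j) (x≗y j))

stepβ-init-last : ∀ x L → stepβ x L ≗ ∑[ j < L ] (qPow (j * j) *ₚ invPochDiff L j *ₚ x j) +ₚ qPow (L * L) *ₚ x L
stepβ-init-last x L = ≗-trans (∑-init-last L (λ j → qPow (j * j) *ₚ invPochDiff L j *ₚ x j))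
  (+ₚ-congˡ (∑[ j < L ] (qPow (j * j) *ₚ invPochDiff L j *ₚ x j))
    (*ₚ-congʳ (x L) (≗-trans (*ₚ-congˡ (qPow (L * L)) (cong-app (invPochDiff-diag L))) (*-identityʳ (qPow (L * L))))))

stepβ-injective : ∀ x y → (∀ L → stepβ x L ≗ stepβ y L) → ∀ L → x L ≗ y L
stepβ-injective x y stepx≗stepy = <-rec (λ L → x L ≗ y L) agree
  where
  agree : ∀ L → (∀ {j} → j < L → x j ≗ y j) → x L ≗ y L
  agree L ih = qPow-*ₚ-cancelˡ (L * L) (+ₚ-cancelˡ (∑[ j < L ] (c j *ₚ x j)) (qPow (L * L) *ₚ x L) (qPow (L * L) *ₚ y L) (begin
    ∑[ j < L ] (c j *ₚ x j) +ₚ qPow (L * L) *ₚ x L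
      ≈⟨ stepβ-init-last x L ⟨
    stepβ x L
      ≈⟨ stepx≗stepy L ⟩
    stepβ y L
      ≈⟨ stepβ-init-last y L ⟩
    ∑[ j < L ] (c j *ₚ y j) +ₚ qPow (L * L) *ₚ y L
      ≈⟨ +ₚ-congʳ (qPow (L * L) *ₚ y L) (∑-cong L (λ j j<L → *ₚ-congˡ (c j) (ih j<L))) ⟨
    ∑[ j < L ] (c j *ₚ x j) +ₚ qPow (L * L) *ₚ y L
      ∎))
    where
    c : ℕ → PS
    c j = qPow (j * j) *ₚ invPochDiff L j

pairMα : ℕ → ℕ → PS
pairMα M r = poch M *ₚ unitα r *ₚ pairKernel M r

pairMβ : ℕ → ℕ → PS
pairMβ M L = qPow (M * L) *ₚ invPoch L *ₚ invPoch (L + M)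

pairMα-finite : ∀ M r → M < r → pairMα M r ≗ 0ₚ
pairMα-finite M r M<r = ≗-trans (*ₚ-congˡ (poch M *ₚ unitα r) (pairKernel-> M<r)) (zeroʳ (poch M *ₚ unitα r))

stepβ-pairMβ : ∀ M L → stepβ (pairMβ M) L ≗ invPoch L *ₚ invPoch (L + M)
stepβ-pairMβ M L = ≗-trans (∑-cong-≗ (suc L) term) (saalschütz∞ L M)
  where
  term : ∀ j → qPow (j * j) *ₚ invPochDiff L j *ₚ pairMβ M j ≗ saalschützTerm L M (λ _ → 1ₚ) j
  term j = begin
    qPow (j * j) *ₚ invPochDiff L j *ₚ (qPow (M * j) *ₚ invPoch j *ₚ invPoch (j + M))
      ≈⟨ solve 5 (λ x D y I J → x :* D :* (y :* I :* J) := (x :* y) :* (D :* I) :* con (+ 1) :* J) ≗-refl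
                 (qPow (j * j)) (invPochDiff L j) (qPow (M * j)) (invPoch j) (invPoch (j + M)) ⟩
    (qPow (j * j) *ₚ qPow (M * j)) *ₚ qbin L j *ₚ 1ₚ *ₚ invPoch (j + M)
      ≈⟨ *ₚ-congʳ (invPoch (j + M)) (*ₚ-congʳ 1ₚ (*ₚ-congʳ (qbin L j) (qPow-+ (j * j) (M * j)))) ⟩
    qPow (j * j + M * j) *ₚ qbin L j *ₚ 1ₚ *ₚ invPoch (j + M)
      ≡⟨ cong₂ (λ e n → qPow (j * j + e) *ₚ qbin L j *ₚ 1ₚ *ₚ invPoch n) (ℕP.*-comm M j) (ℕP.+-comm j M) ⟩
    saalschützTerm L M (λ _ → 1ₚ) j
      ∎

pairβ-qPow-pairMα : ∀ M L → pairβ (λ r → qPow (r * r) *ₚ pairMα M r) L ≗ invPoch L *ₚ invPoch (L + M)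
pairβ-qPow-pairMα M L = begin
  ∑[ r < suc L ] (qPow (r * r) *ₚ pairMα M r *ₚ pairKernel L r)
    ≈⟨ ∑-cong-≗ (suc L) term ⟩
  ∑[ r < suc L ] (u *ₚ (unitα r *ₚ (qPow (r * r) *ₚ poch (L + M) *ₚ pairKernel M r *ₚ pairKernel L r)))
    ≈⟨ *-distribˡ-∑ (suc L) u (λ r → unitα r *ₚ (qPow (r * r) *ₚ poch (L + M) *ₚ pairKernel M r *ₚ pairKernel L r)) ⟨
  u *ₚ ∑[ r < suc L ] (unitα r *ₚ (qPow (r * r) *ₚ poch (L + M) *ₚ pairKernel M r *ₚ pairKernel L r))
    ≈⟨ *ₚ-congˡ u (unitα-kernel-sum L M) ⟩
  poch M *ₚ invPoch (L + M) *ₚ (invPoch L *ₚ invPoch M)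
    ≈⟨ solve 4 (λ p J A B → p :* J :* (A :* B) := (p :* B) :* (A :* J)) ≗-refl (poch M) (invPoch (L + M)) (invPoch L) (invPoch M) ⟩
  (poch M *ₚ invPoch M) *ₚ (invPoch L *ₚ invPoch (L + M))
    ≈⟨ *ₚ-congʳ (invPoch L *ₚ invPoch (L + M)) (poch*invPoch M) ⟩
  1ₚ *ₚ (invPoch L *ₚ invPoch (L + M))
    ≈⟨ *ₚ-identityˡ (invPoch L *ₚ invPoch (L + M)) ⟩
  invPoch L *ₚ invPoch (L + M)
    ∎
  where
  u = poch M *ₚ invPoch (L + M)
  term : ∀ r → qPow (r * r) *ₚ pairMα M r *ₚ pairKernel L r
               ≗ u *ₚ (unitα r *ₚ (qPow (r * r) *ₚ poch (L + M) *ₚ pairKernel M r *ₚ pairKernel L r))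
  term r = begin
    qPow (r * r) *ₚ (poch M *ₚ unitα r *ₚ pairKernel M r) *ₚ pairKernel L r
      ≈⟨ *ₚ-identityˡ _ ⟨
    1ₚ *ₚ (qPow (r * r) *ₚ (poch M *ₚ unitα r *ₚ pairKernel M r) *ₚ pairKernel L r)
      ≈⟨ *ₚ-congʳ (qPow (r * r) *ₚ (poch M *ₚ unitα r *ₚ pairKernel M r) *ₚ pairKernel L r) (poch*invPoch (L + M)) ⟨
    (poch (L + M) *ₚ invPoch (L + M)) *ₚ (qPow (r * r) *ₚ (poch M *ₚ unitα r *ₚ pairKernel M r) *ₚ pairKernel L r)
      ≈⟨ solve 7 (λ P J x p a K K′ → (P :* J) :* (x :* (p :* a :* K) :* K′) := p :* J :* (a :* (x :* P :* K :* K′))) ≗-refl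
                 (poch (L + M)) (invPoch (L + M)) (qPow (r * r)) (poch M) (unitα r) (pairKernel M r) (pairKernel L r) ⟩
    u *ₚ (unitα r *ₚ (qPow (r * r) *ₚ poch (L + M) *ₚ pairKernel M r *ₚ pairKernel L r))
      ∎

pairMα-pairβ : ∀ M L → pairβ (pairMα M) L ≗ pairMβ M L
pairMα-pairβ M = stepβ-injective (pairβ (pairMα M)) (pairMβ M) (λ L → begin
  stepβ (pairβ (pairMα M)) L                     ≈⟨ bailey-lemma (pairMα M) L ⟩
  pairβ (λ r → qPow (r * r) *ₚ pairMα M r) L     ≈⟨ pairβ-qPow-pairMα M L ⟩
  invPoch L *ₚ invPoch (L + M)                   ≈⟨ stepβ-pairMβ M L ⟨
  stepβ (pairMβ M) L                             ∎)

stepβ^ : ℕ → (ℕ → PS) → ℕ → PS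
stepβ^ zero    β = β
stepβ^ (suc k) β = stepβ (stepβ^ k β)

stepβ^-cong : ∀ k {x y} → (∀ L → x L ≗ y L) → ∀ L → stepβ^ k x L ≗ stepβ^ k y L
stepβ^-cong zero    x≗y = x≗y
stepβ^-cong (suc k) x≗y = stepβ-cong (stepβ^-cong k x≗y)

pairβ-cong : ∀ {α α′} → (∀ r → α r ≗ α′ r) → ∀ L → pairβ α L ≗ pairβ α′ L
pairβ-cong {α} {α′} α≗α′ L = ∑-cong-≗ (suc L) (λ r → *ₚ-congʳ (pairKernel L r) (α≗α′ r))

bailey-chain : ∀ k α L → stepβ^ k (pairβ α) L ≗ pairβ (λ r → qPow (k * (r * r)) *ₚ α r) L
bailey-chain zero    α L = pairβ-cong (λ r → ≗-sym (*ₚ-identityˡ (α r))) L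
bailey-chain (suc k) α L = begin
  stepβ (stepβ^ k (pairβ α)) L
    ≈⟨ stepβ-cong (bailey-chain k α) L ⟩
  stepβ (pairβ (λ r → qPow (k * (r * r)) *ₚ α r)) L
    ≈⟨ bailey-lemma (λ r → qPow (k * (r * r)) *ₚ α r) L ⟩
  pairβ (λ r → qPow (r * r) *ₚ (qPow (k * (r * r)) *ₚ α r)) L
    ≈⟨ pairβ-cong (λ r → ≗-trans (≗-sym (*-assoc (qPow (r * r)) (qPow (k * (r * r))) (α r)))
                                 (*ₚ-congʳ (α r) (qPow-+ (r * r) (k * (r * r))))) L ⟩
  pairβ (λ r → qPow (suc k * (r * r)) *ₚ α r) L
    ∎

-- The limit L → ∞

≗⇒≗[≤] : ∀ {f g N} → f ≗ g → f ≗[≤ N ] g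
≗⇒≗[≤] f≗g i _ = f≗g i

≗[≤]-trans : ∀ {f g h N} → f ≗[≤ N ] g → g ≗[≤ N ] h → f ≗[≤ N ] h
≗[≤]-trans f≗g g≗h i i≤N = trans (f≗g i i≤N) (g≗h i i≤N)

≗[≤]-sym : ∀ {f g N} → f ≗[≤ N ] g → g ≗[≤ N ] f
≗[≤]-sym f≗g i i≤N = ≡.sym (f≗g i i≤N)

≗[≤]-weaken : ∀ {f g M N} → M ≤ N → f ≗[≤ N ] g → f ≗[≤ M ] g
≗[≤]-weaken M≤N f≗g i i≤M = f≗g i (ℕP.≤-trans i≤M M≤N)

∑-coeff : ∀ n (F : ℕ → PS) i → ∑ n F i ≡ ℤ∑.∑ n (λ j → F j i)
∑-coeff zero    F i = refl
∑-coeff (suc n) F i = cong (F 0 i +ᶻ_) (∑-coeff n (F ∘ suc) i)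

∑-cong-≤ : ∀ n {F G N} → (∀ j → j < n → F j ≗[≤ N ] G j) → ∑ n F ≗[≤ N ] ∑ n G
∑-cong-≤ n {F} {G} F≗G i i≤N =
  trans (∑-coeff n F i) (trans (ℤ∑.∑-cong n (λ j j<n → F≗G j j<n i i≤N)) (≡.sym (∑-coeff n G i)))

qPow-*ₚ-≗[≤]0 : ∀ {e N} f → N < e → qPow e *ₚ f ≗[≤ N ] 0ₚ
qPow-*ₚ-≗[≤]0 f N<e i i≤N = qPow-*ₚ-> f (ℕP.<-≤-trans (s≤s i≤N) N<e)

invPoch-suc-stable : ∀ a → invPoch (suc a) ≗[≤ a ] invPoch a
invPoch-suc-stable a = ≗[≤]-trans (*ₚ-cong-≤ {invPoch a} (λ _ _ → refl) geomInv≈1) (≗⇒≗[≤] (*-identityʳ (invPoch a)))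
  where
  geomInv≈1 : geomInv a ≗[≤ a ] 1ₚ
  geomInv≈1 i i≤a = trans (geomInv-mod a i) (cong 1ₚ (m<n⇒m%n≡m (s≤s i≤a)))

invPoch-stable : ∀ {a b} → a ≤′ b → invPoch b ≗[≤ a ] invPoch a
invPoch-stable ≤′-refl         = λ _ _ → refl
invPoch-stable (≤′-step a≤′b) = ≗[≤]-trans (≗[≤]-weaken (ℕP.≤′⇒≤ a≤′b) (invPoch-suc-stable _)) (invPoch-stable a≤′b)

invPoch≈invInf : ∀ {N a} → N ≤ a → invPoch a ≗[≤ N ] invInf
invPoch≈invInf N≤a i i≤N = invPoch-stable (ℕP.≤⇒≤′ (ℕP.≤-trans i≤N N≤a)) i ℕP.≤-refl

n≤n*n : ∀ n → n ≤ n * n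
n≤n*n zero    = z≤n
n≤n*n (suc n) = ℕP.m≤m+n (suc n) (n * suc n)

-- The sum Σ_{n ≥ 0} G n, when G n = O(q^n): its coefficient of q^N only involves G 0, …, G N.
∑∞ : (ℕ → PS) → PS
∑∞ G N = ∑ (suc N) G N

∑∞-cong : ∀ {G H} → (∀ n → G n ≗ H n) → ∑∞ G ≗ ∑∞ H
∑∞-cong G≗H N = ∑-cong-≗ (suc N) G≗H N

∑∞-truncate : ∀ G {N L} → (∀ n i → i < n → G n i ≡ + 0) → N ≤ L → ∑∞ G ≗[≤ N ] ∑ (suc L) G
∑∞-truncate G {N} {L} order N≤L i i≤N =
  trans (∑-coeff (suc i) G i)
        (trans (≡.sym (ℤ∑.∑-truncate (λ n → G n i) (s≤s (ℕP.≤-trans i≤N N≤L)) (λ n i<n → order n i i<n)))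
               (≡.sym (∑-coeff (suc L) G i)))

m+n≤o⇒m≤o∸n : ∀ {m n o} → m + n ≤ o → m ≤ o ∸ n
m+n≤o⇒m≤o∸n {m} {n} m+n≤o = subst (_≤ _ ∸ n) (ℕP.m+n∸n≡m m n) (ℕP.∸-monoˡ-≤ n m+n≤o)

stepβ-approx : ∀ β {N L} → N + N ≤ L → invInf *ₚ ∑[ j < suc L ] (qPow (j * j) *ₚ β j) ≗[≤ N ] stepβ β L
stepβ-approx β {N} {L} 2N≤L = ≗[≤]-trans (≗⇒≗[≤] rearrange) (∑-cong-≤ (suc L) term)
  where
  rearrange : invInf *ₚ ∑[ j < suc L ] (qPow (j * j) *ₚ β j) ≗ ∑[ j < suc L ] (qPow (j * j) *ₚ invInf *ₚ β j)
  rearrange = ≗-trans (*-distribˡ-∑ (suc L) invInf (λ j → qPow (j * j) *ₚ β j))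
                      (∑-cong-≗ (suc L) (λ j → solve 3 (λ i x b → i :* (x :* b) := x :* i :* b) ≗-refl invInf (qPow (j * j)) (β j)))
  term : ∀ j → j < suc L → qPow (j * j) *ₚ invInf *ₚ β j ≗[≤ N ] qPow (j * j) *ₚ invPochDiff L j *ₚ β j
  term j j<1+L with j ℕ.≤? N
  ... | yes j≤N = *ₚ-cong-≤ {g = β j} (*ₚ-cong-≤ {qPow (j * j)} (λ _ _ → refl) invInf≈) (λ _ _ → refl)
    where
    invInf≈ : invInf ≗[≤ N ] invPochDiff L j
    invInf≈ = ≗[≤]-sym (≗[≤]-trans (≗⇒≗[≤] (cong-app (invPochDiff-≤ (ℕP.≤-pred j<1+L))))
                                    (invPoch≈invInf (ℕP.≤-trans (m+n≤o⇒m≤o∸n 2N≤L) (ℕP.∸-monoʳ-≤ L j≤N))))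
  ... | no j≰N = ≗[≤]-trans (vanish invInf) (≗[≤]-sym (vanish (invPochDiff L j)))
    where
    vanish : ∀ c → qPow (j * j) *ₚ c *ₚ β j ≗[≤ N ] 0ₚ
    vanish c = ≗[≤]-trans (≗⇒≗[≤] (*-assoc (qPow (j * j)) c (β j)))
                          (qPow-*ₚ-≗[≤]0 (c *ₚ β j) (ℕP.<-≤-trans (ℕP.≰⇒> j≰N) (n≤n*n j)))

pairβ-approx : ∀ α {M N L} → (∀ r → M < r → α r ≗ 0ₚ) → N + M ≤ L →
  pairβ α L ≗[≤ N ] ∑ (suc M) α *ₚ (invInf *ₚ invInf)
pairβ-approx α {M} {N} {L} α-finite N+M≤L =
  ≗[≤]-trans (∑-cong-≤ (suc L) term) (≗⇒≗[≤] (begin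
    ∑[ r < suc L ] (α r *ₚ (invInf *ₚ invInf))
      ≈⟨ *-distribʳ-∑ (suc L) (invInf *ₚ invInf) α ⟨
    ∑ (suc L) α *ₚ (invInf *ₚ invInf)
      ≈⟨ *ₚ-congʳ (invInf *ₚ invInf) (∑-truncate α (s≤s M≤L) α-finite) ⟩
    ∑ (suc M) α *ₚ (invInf *ₚ invInf)
      ∎))
  where
  M≤L = ℕP.m+n≤o⇒n≤o N N+M≤L
  term : ∀ r → r < suc L → α r *ₚ pairKernel L r ≗[≤ N ] α r *ₚ (invInf *ₚ invInf)
  term r r<1+L with M ℕ.<? r
  ... | yes M<r = ≗⇒≗[≤] (≗-trans (vanish (pairKernel L r)) (≗-sym (vanish (invInf *ₚ invInf))))
    where
    vanish : ∀ c → α r *ₚ c ≗ 0ₚ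
    vanish c = ≗-trans (*ₚ-congʳ c (α-finite r M<r)) (zeroˡ c)
  ... | no M≮r = *ₚ-cong-≤ {α r} (λ _ _ → refl)
                   (≗[≤]-trans (≗⇒≗[≤] (pairKernel-≤ (ℕP.≤-pred r<1+L)))
                               (*ₚ-cong-≤ (invPoch≈invInf N≤L∸r) (invPoch≈invInf (ℕP.≤-trans (ℕP.m+n≤o⇒m≤o N N+M≤L) (ℕP.m≤m+n L r)))))
    where
    N≤L∸r = ℕP.≤-trans (m+n≤o⇒m≤o∸n N+M≤L) (ℕP.∸-monoʳ-≤ L (ℕP.≮⇒≥ M≮r))

-- Multiplied by 1/(q)_∞ = lim_{L → ∞} 1/(q)_{L−j}, the left side becomes the limit of stepβ (pairβ α) L,
-- to which the Bailey lemma applies; modulo q^{N+1} both limits are reached at L = 2N + M.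
bailey-limit : ∀ M α → (∀ r → M < r → α r ≗ 0ₚ) →
  ∑∞ (λ n → qPow (n * n) *ₚ pairβ α n) ≗ invInf *ₚ ∑[ r < suc M ] (qPow (r * r) *ₚ α r)
bailey-limit M α α-finite = *ₚ-cancelˡ-unit invInf refl (λ N → agree N N ℕP.≤-refl)
  where
  G : ℕ → PS
  G n = qPow (n * n) *ₚ pairβ α n
  order : ∀ n i → i < n → G n i ≡ + 0
  order n i i<n = qPow-*ₚ-> (pairβ α n) (ℕP.<-≤-trans i<n (n≤n*n n))
  qα-finite : ∀ r → M < r → qPow (r * r) *ₚ α r ≗ 0ₚ
  qα-finite r M<r = ≗-trans (*ₚ-congˡ (qPow (r * r)) (α-finite r M<r)) (zeroʳ (qPow (r * r)))
  agree : ∀ N → invInf *ₚ ∑∞ G ≗[≤ N ] invInf *ₚ (invInf *ₚ ∑[ r < suc M ] (qPow (r * r) *ₚ α r))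
  agree N =
    ≗[≤]-trans (*ₚ-cong-≤ {invInf} (λ _ _ → refl) (∑∞-truncate G order (ℕP.≤-trans (ℕP.m≤m+n N N) (ℕP.m≤m+n (N + N) M))))
   (≗[≤]-trans (stepβ-approx (pairβ α) (ℕP.m≤m+n (N + N) M))
   (≗[≤]-trans (≗⇒≗[≤] (bailey-lemma α (N + N + M)))
   (≗[≤]-trans (pairβ-approx (λ r → qPow (r * r) *ₚ α r) qα-finite (ℕP.+-monoˡ-≤ M (ℕP.m≤m+n N N)))
               (≗⇒≗[≤] (solve 2 (λ S i → S :* (i :* i) := i :* (i :* S)) ≗-refl (∑[ r < suc M ] (qPow (r * r) *ₚ α r)) invInf)))))

choose₂-double : ∀ n → choose₂ (suc n) * 2 ≡ suc n * n
choose₂-double zero    = refl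
choose₂-double (suc n) =
  trans (ℕP.*-distribʳ-+ 2 (suc n) (choose₂ (suc n))) (trans (cong (λ x → suc n * 2 + x) (choose₂-double n)) (expand n))
  where
  expand : ∀ n → suc n * 2 + suc n * n ≡ suc (suc n) * suc n
  expand = ℕ-Solver.solve-∀

expo≡ : ∀ k n → expo k n ≡ k * (n * n) + choose₂ n
expo≡ k n = trans (cong (_/ 2) (double n)) (m*n/n≡m (k * (n * n) + choose₂ n) 2)
  where
  double : ∀ n → n * ((2 * k + 1) * n ∸ 1) ≡ (k * (n * n) + choose₂ n) * 2
  double zero    = cong (_* 2) (≡.sym (trans (ℕP.+-identityʳ (k * 0)) (ℕP.*-zeroʳ k)))
  double (suc n) = trans (cong (λ m → suc n * (m ∸ 1)) (unfold k n))
                  (trans (expand k n) (trans (cong (λ x → k * (suc n * suc n) * 2 + x) (≡.sym (choose₂-double n)))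
                                             (≡.sym (ℕP.*-distribʳ-+ 2 (k * (suc n * suc n)) (choose₂ (suc n))))))
    where
    unfold : ∀ k n → (2 * k + 1) * suc n ≡ suc (2 * k * suc n + n)
    unfold = ℕ-Solver.solve-∀
    expand : ∀ k n → suc n * (2 * k * suc n + n) ≡ k * (suc n * suc n) * 2 + suc n * n
    expand = ℕ-Solver.solve-∀

innerTerm : ℕ → ℕ → ℕ → PS
innerTerm k M n = sign n *ₚ (1ₚ +ₚ qPow n) *ₚ qPow (expo k n) *ₚ invPoch (M ∸ n) *ₚ invPoch (M + n)

innerSum≗∑ : ∀ k M → innerSum k M ≗ ∑[ i < M ] innerTerm k M (suc i)
innerSum≗∑ k M N = trans (sumℤ-applyUpTo (λ n → innerTerm k M n N) suc M) (≡.sym (∑-coeff M (λ i → innerTerm k M (suc i)) N))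

qPow-expo : ∀ k n → qPow (n * n) *ₚ qPow (k * (n * n)) *ₚ qPow (choose₂ n) ≗ qPow (expo (suc k) n)
qPow-expo k n = begin
  qPow (n * n) *ₚ qPow (k * (n * n)) *ₚ qPow (choose₂ n)   ≈⟨ *ₚ-congʳ (qPow (choose₂ n)) (qPow-+ (n * n) (k * (n * n))) ⟩
  qPow (suc k * (n * n)) *ₚ qPow (choose₂ n)              ≈⟨ qPow-+ (suc k * (n * n)) (choose₂ n) ⟩
  qPow (suc k * (n * n) + choose₂ n)                      ≡⟨ cong qPow (expo≡ (suc k) n) ⟨
  qPow (expo (suc k) n)                                   ∎

RHS-term-zero : ∀ k M → qPow 0 *ₚ (qPow (k * 0) *ₚ pairMα M 0) ≗ invPoch M
RHS-term-zero k M = begin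
  qPow 0 *ₚ (qPow (k * 0) *ₚ (poch M *ₚ 1ₚ *ₚ (invPoch M *ₚ invPoch (M + 0))))
    ≡⟨ cong₂ (λ e n → qPow 0 *ₚ (qPow e *ₚ (poch M *ₚ 1ₚ *ₚ (invPoch M *ₚ invPoch n)))) (ℕP.*-zeroʳ k) (ℕP.+-identityʳ M) ⟩
  1ₚ *ₚ (1ₚ *ₚ (poch M *ₚ 1ₚ *ₚ (invPoch M *ₚ invPoch M)))
    ≈⟨ solve 2 (λ p I → con (+ 1) :* (con (+ 1) :* (p :* con (+ 1) :* (I :* I))) := (p :* I) :* I) ≗-refl (poch M) (invPoch M) ⟩
  (poch M *ₚ invPoch M) *ₚ invPoch M
    ≈⟨ *ₚ-congʳ (invPoch M) (poch*invPoch M) ⟩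
  1ₚ *ₚ invPoch M
    ≈⟨ *ₚ-identityˡ (invPoch M) ⟩
  invPoch M
    ∎

RHS-term-suc : ∀ k M i → i < M →
  qPow (suc i * suc i) *ₚ (qPow (k * (suc i * suc i)) *ₚ pairMα M (suc i)) ≗ poch M *ₚ innerTerm (suc k) M (suc i)
RHS-term-suc k M i i<M = begin
  qPow (n * n) *ₚ (qPow (k * (n * n)) *ₚ (poch M *ₚ unitα n *ₚ pairKernel M n))
    ≈⟨ *ₚ-congˡ (qPow (n * n)) (*ₚ-congˡ (qPow (k * (n * n))) (*ₚ-congˡ (poch M *ₚ unitα n) (pairKernel-≤ i<M))) ⟩
  qPow (n * n) *ₚ (qPow (k * (n * n)) *ₚ (poch M *ₚ unitα n *ₚ (invPoch (M ∸ n) *ₚ invPoch (M + n))))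
    ≈⟨ solve 8 (λ a b p s c o I J → a :* (b :* (p :* (s :* c :* o) :* (I :* J))) := p :* (s :* o :* (a :* b :* c) :* I :* J)) ≗-refl
               (qPow (n * n)) (qPow (k * (n * n))) (poch M) s (qPow (choose₂ n)) o (invPoch (M ∸ n)) (invPoch (M + n)) ⟩
  poch M *ₚ (s *ₚ o *ₚ (qPow (n * n) *ₚ qPow (k * (n * n)) *ₚ qPow (choose₂ n)) *ₚ invPoch (M ∸ n) *ₚ invPoch (M + n))
    ≈⟨ *ₚ-congˡ (poch M) (*ₚ-congʳ (invPoch (M + n)) (*ₚ-congʳ (invPoch (M ∸ n)) (*ₚ-congˡ (s *ₚ o) (qPow-expo k n)))) ⟩
  poch M *ₚ innerTerm (suc k) M n
    ∎
  where
  n = suc i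
  s = sign n
  o = 1ₚ +ₚ qPow n

RHS≗ : ∀ k M → RHS (suc k) M ≗ invInf *ₚ ∑[ r < suc M ] (qPow (r * r) *ₚ (qPow (k * (r * r)) *ₚ pairMα M r))
RHS≗ k M = ≗-sym (begin
  invInf *ₚ ∑[ r < suc M ] (qPow (r * r) *ₚ (qPow (k * (r * r)) *ₚ pairMα M r))
    ≈⟨ *ₚ-congˡ invInf (+ₚ-cong (RHS-term-zero k M) (∑-cong M (RHS-term-suc k M))) ⟩
  invInf *ₚ (invPoch M +ₚ ∑[ i < M ] (poch M *ₚ innerTerm (suc k) M (suc i)))
    ≈⟨ *ₚ-congˡ invInf (+ₚ-congˡ (invPoch M) (*-distribˡ-∑ M (poch M) (λ i → innerTerm (suc k) M (suc i)))) ⟨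
  invInf *ₚ (invPoch M +ₚ poch M *ₚ ∑[ i < M ] innerTerm (suc k) M (suc i))
    ≈⟨ *ₚ-congˡ invInf (+ₚ-congˡ (invPoch M) (*ₚ-congˡ (poch M) (innerSum≗∑ (suc k) M))) ⟨
  invInf *ₚ (invPoch M +ₚ poch M *ₚ innerSum (suc k) M)
    ≈⟨ solve 4 (λ i a p s → i :* (a :+ p :* s) := i :* a :+ p :* i :* s) ≗-refl invInf (invPoch M) (poch M) (innerSum (suc k) M) ⟩
  RHS (suc k) M
    ∎)

tupleSum : ∀ k → ℕ → (Vec ℕ k → PS) → PS
tupleSum zero    N g = g []
tupleSum (suc k) N g = ∑[ n < suc N ] tupleSum k N (λ t → g (n ∷ t))

tupleSum-cong : ∀ k N {g g′ : Vec ℕ k → PS} → (∀ t → g t ≗ g′ t) → tupleSum k N g ≗ tupleSum k N g′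
tupleSum-cong zero    N g≗g′ = g≗g′ []
tupleSum-cong (suc k) N g≗g′ = ∑-cong-≗ (suc N) (λ n → tupleSum-cong k N (λ t → g≗g′ (n ∷ t)))

*-distribˡ-tupleSum : ∀ k N c (g : Vec ℕ k → PS) → c *ₚ tupleSum k N g ≗ tupleSum k N (λ t → c *ₚ g t)
*-distribˡ-tupleSum zero    N c g = ≗-refl
*-distribˡ-tupleSum (suc k) N c g = ≗-trans (*-distribˡ-∑ (suc N) c (λ n → tupleSum k N (λ t → g (n ∷ t))))
                                            (∑-cong-≗ (suc N) (λ n → *-distribˡ-tupleSum k N c (λ t → g (n ∷ t))))

sumℤ-++ : ∀ xs ys → sumℤ (xs ++ ys) ≡ sumℤ xs +ᶻ sumℤ ys
sumℤ-++ []       ys = ≡.sym (ℤP.+-identityˡ (sumℤ ys))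
sumℤ-++ (x ∷ xs) ys = trans (cong (x +ᶻ_) (sumℤ-++ xs ys)) (≡.sym (ℤP.+-assoc x (sumℤ xs) (sumℤ ys)))

sumℤ-concat : ∀ xss → sumℤ (concat xss) ≡ sumℤ (map sumℤ xss)
sumℤ-concat []         = refl
sumℤ-concat (xs ∷ xss) = trans (sumℤ-++ xs (concat xss)) (cong (sumℤ xs +ᶻ_) (sumℤ-concat xss))

sumℤ-tuples : ∀ k N (g : Vec ℕ k → PS) i → sumℤ (map (λ v → g v i) (tuples k N)) ≡ tupleSum k N g i
sumℤ-tuples zero    N g i = ℤP.+-identityʳ (g [] i)
sumℤ-tuples (suc k) N g i =
  trans (cong sumℤ (List.map-concatMap (λ v → g v i) (λ n → map (n ∷_) (tuples k N)) (upTo (suc N))))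
  (trans (sumℤ-concat (map (λ n → map (λ v → g v i) (map (n ∷_) (tuples k N))) (upTo (suc N))))
  (trans (cong sumℤ (≡.sym (List.map-∘ {g = sumℤ} {f = λ n → map (λ v → g v i) (map (n ∷_) (tuples k N))} (upTo (suc N)))))
  (trans (cong sumℤ (List.map-cong (λ n → trans (cong sumℤ (≡.sym (List.map-∘ {g = λ v → g v i} {f = n ∷_} (tuples k N))))
                                                 (sumℤ-tuples k N (λ t → g (n ∷ t)) i))
                                   (upTo (suc N))))
  (trans (sumℤ-applyUpTo (λ n → tupleSum k N (λ t → g (n ∷ t)) i) id (suc N))
         (≡.sym (∑-coeff (suc N) (λ n → tupleSum k N (λ t → g (n ∷ t))) i))))))

summand-∷ : ∀ M {k} n m (t : Vec ℕ k) → summand M (n ∷ m ∷ t) ≗ qPow (n * n) *ₚ invPochDiff n m *ₚ summand M (m ∷ t)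
summand-∷ M n m t = begin
  qPow (n * n + sumSq (m ∷ t) + M * Vec.last (m ∷ t)) *ₚ (invPochDiff n m *ₚ denom M (m ∷ t))
    ≡⟨ cong (λ e → qPow e *ₚ (invPochDiff n m *ₚ denom M (m ∷ t))) (ℕP.+-assoc (n * n) (sumSq (m ∷ t)) (M * Vec.last (m ∷ t))) ⟩
  qPow (n * n + e) *ₚ (invPochDiff n m *ₚ denom M (m ∷ t))
    ≈⟨ *ₚ-congʳ (invPochDiff n m *ₚ denom M (m ∷ t)) (qPow-+ (n * n) e) ⟨
  (qPow (n * n) *ₚ qPow e) *ₚ (invPochDiff n m *ₚ denom M (m ∷ t))
    ≈⟨ solve 4 (λ x y D d → (x :* y) :* (D :* d) := x :* D :* (y :* d)) ≗-refl
               (qPow (n * n)) (qPow e) (invPochDiff n m) (denom M (m ∷ t)) ⟩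
  qPow (n * n) *ₚ invPochDiff n m *ₚ summand M (m ∷ t)
    ∎
  where
  e = sumSq (m ∷ t) + M * Vec.last (m ∷ t)

tupleSum-summand : ∀ M k N n → n ≤ N → tupleSum k N (λ t → summand M (n ∷ t)) ≗ qPow (n * n) *ₚ stepβ^ k (pairMβ M) n
tupleSum-summand M zero N n _ = begin
  qPow (n * n + 0 + M * n) *ₚ (invPoch n *ₚ invPoch (n + M))
    ≡⟨ cong (λ e → qPow (e + M * n) *ₚ (invPoch n *ₚ invPoch (n + M))) (ℕP.+-identityʳ (n * n)) ⟩
  qPow (n * n + M * n) *ₚ (invPoch n *ₚ invPoch (n + M))
    ≈⟨ *ₚ-congʳ (invPoch n *ₚ invPoch (n + M)) (qPow-+ (n * n) (M * n)) ⟨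
  (qPow (n * n) *ₚ qPow (M * n)) *ₚ (invPoch n *ₚ invPoch (n + M))
    ≈⟨ solve 4 (λ x y I J → (x :* y) :* (I :* J) := x :* (y :* I :* J)) ≗-refl (qPow (n * n)) (qPow (M * n)) (invPoch n) (invPoch (n + M)) ⟩
  qPow (n * n) *ₚ pairMβ M n
    ∎
tupleSum-summand M (suc k) N n n≤N = begin
  ∑[ m < suc N ] tupleSum k N (λ t → summand M (n ∷ m ∷ t))
    ≈⟨ ∑-cong-≗ (suc N) (λ m → tupleSum-cong k N (summand-∷ M n m)) ⟩
  ∑[ m < suc N ] tupleSum k N (λ t → c m *ₚ summand M (m ∷ t))
    ≈⟨ ∑-cong-≗ (suc N) (λ m → *-distribˡ-tupleSum k N (c m) (λ t → summand M (m ∷ t))) ⟨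
  ∑[ m < suc N ] (c m *ₚ tupleSum k N (λ t → summand M (m ∷ t)))
    ≈⟨ ∑-cong (suc N) (λ m m≤N → *ₚ-congˡ (c m) (tupleSum-summand M k N m (ℕP.≤-pred m≤N))) ⟩
  ∑[ m < suc N ] (c m *ₚ (qPow (m * m) *ₚ stepβ^ k (pairMβ M) m))
    ≈⟨ ∑-cong-≗ (suc N) (λ m → solve 4 (λ x D y b → x :* D :* (y :* b) := x :* (y :* D :* b)) ≗-refl
                                       (qPow (n * n)) (invPochDiff n m) (qPow (m * m)) (stepβ^ k (pairMβ M) m)) ⟩
  ∑[ m < suc N ] (qPow (n * n) *ₚ term m)
    ≈⟨ *-distribˡ-∑ (suc N) (qPow (n * n)) term ⟨
  qPow (n * n) *ₚ ∑ (suc N) term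
    ≈⟨ *ₚ-congˡ (qPow (n * n)) (∑-truncate term (s≤s n≤N) beyond) ⟩
  qPow (n * n) *ₚ stepβ^ (suc k) (pairMβ M) n
    ∎
  where
  c : ℕ → PS
  c m = qPow (n * n) *ₚ invPochDiff n m
  term : ℕ → PS
  term m = qPow (m * m) *ₚ invPochDiff n m *ₚ stepβ^ k (pairMβ M) m
  beyond : ∀ m → suc n ≤ m → term m ≗ 0ₚ
  beyond m n<m = ≗-trans (*ₚ-congʳ (stepβ^ k (pairMβ M) m) (*ₚ-congˡ (qPow (m * m)) (cong-app (invPochDiff-> n<m))))
                         (solve 2 (λ x b → x :* con (+ 0) :* b := con (+ 0)) ≗-refl (qPow (m * m)) (stepβ^ k (pairMβ M) m))

LHS≡∑∞ : ∀ k M N → LHS (suc k) M N ≡ ∑∞ (λ n → qPow (n * n) *ₚ stepβ^ k (pairMβ M) n) N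
LHS≡∑∞ k M N = trans (sumℤ-tuples (suc k) N (summand M) N)
                     (∑-cong (suc N) (λ n n≤N → tupleSum-summand M k N n (ℕP.≤-pred n≤N)) N)

corollary6 : (k M : ℕ) → 1 ≤ k → (N : ℕ) → LHS k M N ≡ RHS k M N
corollary6 (suc k) M _ N = trans (LHS≡∑∞ k M N) (∑∞≗RHS N)
  where
  α : ℕ → PS
  α r = qPow (k * (r * r)) *ₚ pairMα M r
  ∑∞≗RHS : ∑∞ (λ n → qPow (n * n) *ₚ stepβ^ k (pairMβ M) n) ≗ RHS (suc k) M
  ∑∞≗RHS = begin
    ∑∞ (λ n → qPow (n * n) *ₚ stepβ^ k (pairMβ M) n)
      ≈⟨ ∑∞-cong (λ n → *ₚ-congˡ (qPow (n * n)) (stepβ^-cong k (λ L → ≗-sym (pairMα-pairβ M L)) n)) ⟩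
    ∑∞ (λ n → qPow (n * n) *ₚ stepβ^ k (pairβ (pairMα M)) n)
      ≈⟨ ∑∞-cong (λ n → *ₚ-congˡ (qPow (n * n)) (bailey-chain k (pairMα M) n)) ⟩
    ∑∞ (λ n → qPow (n * n) *ₚ pairβ α n)
      ≈⟨ bailey-limit M α (λ r M<r → ≗-trans (*ₚ-congˡ (qPow (k * (r * r))) (pairMα-finite M r M<r)) (zeroʳ (qPow (k * (r * r))))) ⟩
    invInf *ₚ ∑[ r < suc M ] (qPow (r * r) *ₚ α r)
      ≈⟨ RHS≗ k M ⟨
    RHS (suc k) M
      ∎
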